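{- There exists a periodic graph $\mathcal{G}$ with footprint $G$ such that $c(\mathcal{G})<c(G_{\max})<c(G)$.
   Context: All graphs are finite, undirected and reflexive. A periodic graph with period $p\ge1$ is a sequence $\mathcal{G}=(G_0,\dots,G_{p-1})$ of graphs $G_i=(V,E_i)$ on a common vertex set, extended by $G_{i+p}=G_i$; its footprint is $G=(V,\bigcup_iE_i)$, assumed connected. Cops and Robber on a periodic graph with $k$ cops (perfect information): cops choose starting vertices, then the robber; in each round $t=0,1,\dots$ each cop moves to a vertex of $N_{G_{t\bmod p}}[\text{its position}]$, then the robber likewise; the cops win if a cop ever moves onto the robber's vertex. The cop number $c(\cdot)$ is the least $k$ such that $k$ cops have a winning strategy; a static graph is a periodic graph of period $1$. $c(G_{\max})=\max_{0\le i\le p-1}c(G_i)$. -}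

module Defs where

open import Data.Nat using (ℕ; zero; suc; _<_; _≤_)
open import Data.Nat.DivMod using (_mod_)
open import Data.Fin using (Fin)
open import Data.Product using (Σ; ∃; ∃-syntax; _×_; _,_)
open import Data.Sum using (_⊎_)
open import Relation.Nullary using (¬_)
open import Relation.Binary.PropositionalEquality using (_≡_)

record Graph (n : ℕ) : Set₁ where
  field
    Adj      : Fin n → Fin n → Set
    adj-refl : ∀ v → Adj v v
    adj-sym  : ∀ {u v} → Adj u v → Adj v u
open Graph public

_∋_⟶_ : ∀ {n} → Graph n → Fin n → Fin n → Set
G ∋ u ⟶ v = Adj G u v

record PeriodicGraph (n : ℕ) : Set₁ where
  field
    q      : ℕ
    layers : Fin (suc q) → Graph n
  period : ℕ
  period = suc q
  layerAt : ℕ → Graph n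
  layerAt t = layers (t mod suc q)
open PeriodicGraph public

static : ∀ {n} → Graph n → PeriodicGraph n
static G = record { q = 0 ; layers = λ _ → G }

footprint : ∀ {n} → PeriodicGraph n → Graph n
footprint {n} 𝒢 = record
  { Adj = λ u v → ∃[ i ] Adj (layers 𝒢 i) u v
  ; adj-refl = λ v → Data.Fin.zero , adj-refl (layers 𝒢 Data.Fin.zero) v
  ; adj-sym = λ { (i , a) → i , adj-sym (layers 𝒢 i) a }
  }

-- Reachability and connectedness (connected graphs are nonempty).
data Reach {n} (G : Graph n) (u : Fin n) : Fin n → Set where
  here : Reach G u u
  step : ∀ {v w} → Reach G u v → Adj G v w → Reach G u w

Connected : ∀ {n} → Graph n → Set
Connected {n} G = Fin n × (∀ u v → Reach G u v)

-- CopWin 𝒢 t cops r : at the start of round t, with the k cops at positions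
-- `cops` and the robber at r, the cops have a winning strategy (capture
-- is forced in finitely many rounds). A proof term is exactly such a strategy.
-- In round t the cops move in G_t, then (if no capture) the robber moves in G_t.
data CopWin {n k : ℕ} (𝒢 : PeriodicGraph n) (t : ℕ)
            (cops : Fin k → Fin n) (r : Fin n) : Set where
  move : (cops' : Fin k → Fin n)
       → (∀ i → Adj (layerAt 𝒢 t) (cops i) (cops' i))
       → (∃[ i ] cops' i ≡ r)
         ⊎ (∀ r' → Adj (layerAt 𝒢 t) r r' → CopWin 𝒢 (suc t) cops' r')
       → CopWin 𝒢 t cops r

CopsWin : ∀ {n} → PeriodicGraph n → ℕ → Set
CopsWin {n} 𝒢 k = ∃[ cops ] ∀ (r : Fin n) → CopWin {n} {k} 𝒢 0 cops r

CopNumber : ∀ {n} → PeriodicGraph n → ℕ → Set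
CopNumber 𝒢 m = CopsWin 𝒢 m × (∀ j → j < m → ¬ CopsWin 𝒢 j)

MaxLayerCopNumber : ∀ {n} → PeriodicGraph n → ℕ → Set
MaxLayerCopNumber 𝒢 m =
  (∀ i → ∃[ c ] CopNumber (static (layers 𝒢 i)) c × c ≤ m)
  × (∃[ i ] CopNumber (static (layers 𝒢 i)) m)

module Submission where

-- The footprint of split-petersen is the Petersen graph, with cop number 3: the closed
-- neighbourhoods of 0, 2 and 6 cover it, and since it is 3-regular of girth 5, two cops
-- not standing on a vertex r see at most three of the four vertices of its closed
-- neighbourhood, so a robber unseen by two cops can always move to a vertex they still
-- do not see. The Petersen edges are split into the layers G₀ (cop number 2) and the
-- spanning tree G₁ (cop number 1), and in the periodic game alternating them a single
-- cop wins.
--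
-- The cops' wins on G₀, G₁ and split-petersen are checked against certificates computed
-- by backward induction: a positional strategy together with the number of rounds it
-- needs to capture the robber, which drops along every reply of the robber.

open import Defs
open import Function using (_∘_)
open import Data.Nat using (ℕ; zero; suc; _+_; _*_; _%_; _/_; _<_; _≤_; _<?_; z≤n; s≤s⁻¹)
open import Data.Nat.Properties using (<-≤-trans; ≤-refl; n≤1+n; n<1+n; m≤n⇒m<n∨m≡n)
open import Data.Nat.DivMod using (_mod_; m%n<n; m≡m%n+[m/n]*n; [m+kn]%n≡m%n)
open import Data.Fin using (Fin; zero; suc; toℕ; _≟_; #_)
open import Data.Fin.Properties using (toℕ-fromℕ<; toℕ-injective; any?; all?)
open import Data.Vec using (Vec; []; _∷_; lookup; map; tabulate)
open import Data.Vec.Properties using (lookup-map; lookup∘tabulate)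
import Data.Vec.Functional as Vector
open import Data.List using (List; []; _∷_)
open import Data.Empty using (⊥)
open import Data.Product using (Σ; ∃; ∃-syntax; _×_; _,_)
open import Data.Sum using (_⊎_; inj₁; inj₂; [_,_])
import Data.Sum as Sum
open import Relation.Nullary using (¬_; Dec; yes; no; contradiction; ⊤-dec; _×-dec_; _⊎-dec_; _→-dec_; ¬?; map′)
open import Relation.Nullary.Decidable using (toWitness; True)
open import Relation.Binary.PropositionalEquality using (_≡_; refl; sym; trans; cong; subst; subst₂)
open import Data.List.Relation.Unary.Any using (Any)
import Data.List.Relation.Unary.Any as Any
import Data.Nat as ℕ
import Data.List.Membership.DecPropositional as DecMembership

module _ {n : ℕ} where

  Joins : Fin n → Fin n → ℕ × ℕ → Set
  Joins u v (a , b) = a ≡ toℕ u × b ≡ toℕ v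

  Edge : List (ℕ × ℕ) → Fin n → Fin n → Set
  Edge E u v = u ≡ v ⊎ Any (Joins u v) E ⊎ Any (Joins v u) E

  edge? : ∀ E u v → Dec (Edge E u v)
  edge? E u v = u ≟ v ⊎-dec Any.any? (joins? u v) E ⊎-dec Any.any? (joins? v u) E
    where
    joins? : ∀ u v e → Dec (Joins u v e)
    joins? u v (a , b) = a ℕ.≟ toℕ u ×-dec b ℕ.≟ toℕ v

  fromEdges : List (ℕ × ℕ) → Graph n
  fromEdges E = record
    { Adj      = Edge E
    ; adj-refl = λ v → inj₁ refl
    ; adj-sym  = [ inj₁ ∘ sym , inj₂ ∘ Sum.swap ]
    }

module _ {n : ℕ} (G : Graph n) (adj? : ∀ u v → Dec (Adj G u v)) where

  Within : ℕ → Fin n → Fin n → Set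
  Within zero    u v = u ≡ v
  Within (suc m) u v = Within m u v ⊎ ∃[ w ] Within m u w × Adj G w v

  within? : ∀ m u v → Dec (Within m u v)
  within? zero    = _≟_
  within? (suc m) u v = within? m u v ⊎-dec any? λ w → within? m u w ×-dec adj? w v

  within⇒reach : ∀ m {u v} → Within m u v → Reach G u v
  within⇒reach zero    refl                    = here
  within⇒reach (suc m) (inj₁ p)                = within⇒reach m p
  within⇒reach (suc m) (inj₂ (w , p , w~v))    = step (within⇒reach m p) w~v

  connected-by-diameter : ∀ m → Fin n → True (all? λ u → all? λ v → within? m u v) → Connected G
  connected-by-diameter m v h = v , λ u w → within⇒reach m (toWitness h u w)

Config : ℕ → ℕ → Set
Config n k = Vec (Fin n) k

module _ {n : ℕ} where

  all-configs? : ∀ k {P : Config n k → Set} → (∀ cs → Dec (P cs)) → Dec (∀ cs → P cs)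
  all-configs? zero    P? = map′ (λ { p [] → p }) (λ f → f []) (P? [])
  all-configs? (suc k) P? =
    map′ (λ { f (c ∷ cs) → f c cs }) (λ f c cs → f (c ∷ cs))
         (all? λ c → all-configs? k λ cs → P? (c ∷ cs))

ConfigTable : ℕ → ℕ → Set → Set
ConfigTable n zero    A = A
ConfigTable n (suc k) A = Vec (ConfigTable n k A) n

lookupᶜ : ∀ {n k A} → ConfigTable n k A → Config n k → A
lookupᶜ t []       = t
lookupᶜ t (c ∷ cs) = lookupᶜ (lookup t c) cs

Table : ∀ {n} → PeriodicGraph n → ℕ → Set → Set
Table {n} 𝒢 k A = Vec (ConfigTable n k (Vec A n)) (period 𝒢)

module Game {n : ℕ} (𝒢 : PeriodicGraph n)
            (adj? : ∀ i u v → Dec (Adj (layers 𝒢 i) u v)) where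

  Phase : Set
  Phase = Fin (period 𝒢)

  phase : ℕ → Phase
  phase t = t mod period 𝒢

  next : Phase → Phase
  next i = suc (toℕ i) mod period 𝒢

  phase-suc : ∀ t → phase (suc t) ≡ next (phase t)
  phase-suc t = toℕ-injective (begin
      toℕ (phase (suc t))           ≡⟨ toℕ-fromℕ< (m%n<n (suc t) p) ⟩
      suc t % p                     ≡⟨ cong (λ x → suc x % p) (m≡m%n+[m/n]*n t p) ⟩
      (suc (t % p) + t / p * p) % p ≡⟨ [m+kn]%n≡m%n (suc (t % p)) (t / p) p ⟩
      suc (t % p) % p               ≡⟨ cong (λ x → suc x % p) (sym (toℕ-fromℕ< (m%n<n t p))) ⟩
      suc (toℕ (phase t)) % p       ≡⟨ sym (toℕ-fromℕ< (m%n<n (suc (toℕ (phase t))) p)) ⟩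
      toℕ (next (phase t))          ∎)
    where
    open Relation.Binary.PropositionalEquality.≡-Reasoning
    p = period 𝒢

  lookupᵗ : ∀ {k A} → Table 𝒢 k A → Phase → Config n k → Fin n → A
  lookupᵗ t i cs r = lookup (lookupᶜ (lookup t i) cs) r

  module _ {k : ℕ} where

    Moves : Phase → Config n k → Config n k → Set
    Moves i cs cs' = ∀ j → Adj (layers 𝒢 i) (lookup cs j) (lookup cs' j)

    Catches : Config n k → Fin n → Set
    Catches cs r = ∃[ j ] lookup cs j ≡ r

    Dominated : Phase → Config n k → Fin n → Set
    Dominated i cs r = ∃[ j ] Adj (layers 𝒢 i) (lookup cs j) r

    moves? : ∀ i cs cs' → Dec (Moves i cs cs')
    moves? i cs cs' = all? λ j → adj? i (lookup cs j) (lookup cs' j)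

    catches? : ∀ cs r → Dec (Catches cs r)
    catches? cs r = any? λ j → lookup cs j ≟ r

    dominated? : ∀ i cs r → Dec (Dominated i cs r)
    dominated? i cs r = any? λ j → adj? i (lookup cs j) r

    Winning : Phase → Config n k → Fin n → Set
    Winning i cs r = ∀ t → phase t ≡ i → CopWin 𝒢 t (lookup cs) r

    winning-by-move : ∀ i cs r cs' → Moves i cs cs' →
      Catches cs' r ⊎ (∀ r' → Adj (layers 𝒢 i) r r' → Winning (next i) cs' r') →
      Winning i cs r
    winning-by-move i cs r cs' mv res t refl =
      move (lookup cs') mv (Sum.map₂ (λ win r' r~r' → win r' r~r' (suc t) (phase-suc t)) res)

    module Ranking (rank : Phase → Config n k → Fin n → ℕ)
                   (strategy : Phase → Config n k → Fin n → Config n k) where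

      Decreases : Phase → Config n k → Fin n → Set
      Decreases i cs r = Moves i cs (strategy i cs r) ×
        (Catches (strategy i cs r) r ⊎
         ∀ r' → Adj (layers 𝒢 i) r r' → rank (next i) (strategy i cs r) r' < rank i cs r)

      decreases? : ∀ i cs r → Dec (Decreases i cs r)
      decreases? i cs r = moves? i cs (strategy i cs r) ×-dec
        (catches? (strategy i cs r) r ⊎-dec
         all? λ r' → adj? i r r' →-dec rank (next i) (strategy i cs r) r' <? rank i cs r)

      winning-below : (∀ i cs r → Decreases i cs r) →
        ∀ m i cs r → rank i cs r < m → Winning i cs r
      winning-below decreasing (suc m) i cs r rank<m with mv , res ← decreasing i cs r =
        winning-by-move i cs r (strategy i cs r) mv (Sum.map₂ descend res)
        where
        descend : (∀ r' → Adj (layers 𝒢 i) r r' → rank (next i) (strategy i cs r) r' < rank i cs r) →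
                  ∀ r' → Adj (layers 𝒢 i) r r' → Winning (next i) (strategy i cs r) r'
        descend down r' r~r' = winning-below decreasing m _ _ r' (<-≤-trans (down r' r~r') (s≤s⁻¹ rank<m))

    chase : Phase → Fin n → Fin n → Fin n
    chase i r c with adj? i c r
    ... | yes _ = r
    ... | no  _ = c

    chase-moves : ∀ i r c → Adj (layers 𝒢 i) c (chase i r c)
    chase-moves i r c with adj? i c r
    ... | yes c~r = c~r
    ... | no  _   = adj-refl (layers 𝒢 i) c

    chase-catches : ∀ i r c → Adj (layers 𝒢 i) c r → chase i r c ≡ r
    chase-catches i r c c~r with adj? i c r
    ... | yes _   = refl
    ... | no  c≁r = contradiction c~r c≁r

    dominated-winning : ∀ i cs r → Dominated i cs r → Winning i cs r
    dominated-winning i cs r (j , c~r) = winning-by-move i cs r (map (chase i r) cs)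
      (λ j → subst (Adj (layers 𝒢 i) _) (sym (lookup-map j (chase i r) cs)) (chase-moves i r _))
      (inj₁ (j , trans (lookup-map j (chase i r) cs) (chase-catches i r _ c~r)))

    module Evasion (Safe : Fin n → Set) where

      Unseen : Phase → Config n k → Fin n → Set
      Unseen i cs r = Safe r × ¬ Dominated i cs r

      Evades : Phase → Config n k → Fin n → Set
      Evades i cs r = ∃[ r' ] Adj (layers 𝒢 i) r r' × Unseen (next i) cs r'

      evades? : (∀ r → Dec (Safe r)) → ∀ i cs r → Dec (Evades i cs r)
      evades? safe? i cs r = any? λ r' → adj? i r r' ×-dec safe? r' ×-dec ¬? (dominated? (next i) cs r')

      losing : (∀ i cs r → Safe r → ¬ Catches cs r → Evades i cs r) →
        ∀ t cops r → Unseen (phase t) (tabulate cops) r → ¬ CopWin 𝒢 t cops r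
      losing evade t cops r (safe , unseen) (move cops' mv res) = respond res
        where
        sees : ∀ j → cops' j ≡ r → Dominated (phase t) (tabulate cops) r
        sees j caught = j , subst₂ (Adj (layers 𝒢 (phase t))) (sym (lookup∘tabulate cops j)) caught (mv j)
        respond : (∃[ j ] cops' j ≡ r) ⊎ (∀ r' → Adj (layers 𝒢 (phase t)) r r' → CopWin 𝒢 (suc t) cops' r') → ⊥
        respond (inj₁ (j , caught)) = unseen (sees j caught)
        respond (inj₂ h)
          with r' , r~r' , unseen' ← evade (phase t) (tabulate cops') r safe
                                       (λ (j , caught) → unseen (sees j (trans (sym (lookup∘tabulate cops' j)) caught)))
          = losing evade (suc t) cops' r' (subst (λ i → Unseen i (tabulate cops') r') (sym (phase-suc t)) unseen') (h r' r~r')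

  cops-win-by-ranking : ∀ k (rank : Table 𝒢 k ℕ) (strategy : Table 𝒢 k (Config n k)) (cs : Config n k) →
    True (all? λ i → all-configs? k λ cs → all? λ r → Ranking.decreases? (lookupᵗ rank) (lookupᵗ strategy) i cs r) →
    CopsWin 𝒢 k
  cops-win-by-ranking k rank strategy cs h =
    lookup cs , λ r → winning-below (λ i cs r → toWitness h i cs r) _ (phase 0) cs r ≤-refl 0 refl
    where open Ranking (lookupᵗ rank) (lookupᵗ strategy)

  cops-win-by-domination : ∀ k (cs : Config n k) →
    True (all? λ r → dominated? (phase 0) cs r) → CopsWin 𝒢 k
  cops-win-by-domination k cs h =
    lookup cs , λ r → dominated-winning (phase 0) cs r (toWitness h r) 0 refl

  robber-wins-by-evasion : ∀ k (Safe : Fin n → Set) (safe? : ∀ r → Dec (Safe r)) →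
    True (all? λ i → all-configs? k λ cs → all? λ r →
            safe? r →-dec ¬? (catches? cs r) →-dec Evasion.evades? Safe safe? i cs r) →
    True (all-configs? k λ cs → any? λ r → safe? r ×-dec ¬? (dominated? (phase 0) cs r)) →
    ¬ CopsWin 𝒢 k
  robber-wins-by-evasion k Safe safe? evade start (cops , win)
    with r , unseen ← toWitness start (tabulate cops) =
    Evasion.losing Safe (λ i cs r → toWitness evade i cs r) 0 cops r unseen (win r)

module _ {n : ℕ} {𝒢 : PeriodicGraph n} where

  no-cop-catches : ∀ {t} {cops : Fin 0 → Fin n} {r} → ¬ CopWin 𝒢 t cops r
  no-cop-catches (move _ _ (inj₁ (() , _)))
  no-cop-catches {t} {r = r} (move _ _ (inj₂ h)) = no-cop-catches (h r (adj-refl (layerAt 𝒢 t) r))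

  no-cops-lose : Fin n → ¬ CopsWin 𝒢 0
  no-cops-lose r (_ , win) = no-cop-catches (win r)

  idle-cop : ∀ {k t} {cops : Fin k → Fin n} {r} v → CopWin 𝒢 t cops r → CopWin 𝒢 t (v Vector.∷ cops) r
  idle-cop {t = t} {cops} v (move cops' mv res) = move (v Vector.∷ cops') mv' (respond res)
    where
    mv' : ∀ j → Adj (layerAt 𝒢 t) ((v Vector.∷ cops) j) ((v Vector.∷ cops') j)
    mv' zero    = adj-refl (layerAt 𝒢 t) v
    mv' (suc j) = mv j
    respond : ∀ {r} → (∃[ j ] cops' j ≡ r) ⊎ (∀ r' → Adj (layerAt 𝒢 t) r r' → CopWin 𝒢 (suc t) cops' r') →
      (∃[ j ] (v Vector.∷ cops') j ≡ r) ⊎ (∀ r' → Adj (layerAt 𝒢 t) r r' → CopWin 𝒢 (suc t) (v Vector.∷ cops') r')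
    respond (inj₁ (j , caught)) = inj₁ (suc j , caught)
    respond (inj₂ h)            = inj₂ λ r' r~r' → idle-cop v (h r' r~r')

  more-cops-win : Fin n → ∀ {k} → CopsWin 𝒢 k → CopsWin 𝒢 (suc k)
  more-cops-win v (cops , win) = v Vector.∷ cops , λ r → idle-cop v (win r)

  fewer-cops-lose : Fin n → ∀ {j m} → j ≤ m → ¬ CopsWin 𝒢 m → ¬ CopsWin 𝒢 j
  fewer-cops-lose v {m = zero}  z≤n   lose = lose
  fewer-cops-lose v {m = suc m} j≤1+m lose with m≤n⇒m<n∨m≡n j≤1+m
  ... | inj₁ j<1+m = fewer-cops-lose v (s≤s⁻¹ j<1+m) (lose ∘ more-cops-win v)
  ... | inj₂ refl  = lose

  cop-number : Fin n → ∀ {m} → CopsWin 𝒢 (suc m) → ¬ CopsWin 𝒢 m → CopNumber 𝒢 (suc m)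
  cop-number v win lose = win , λ j j<1+m → fewer-cops-lose v (s≤s⁻¹ j<1+m) lose

edges₀ edges₁ : List (ℕ × ℕ)
edges₀ = (0 , 1) ∷ (0 , 4) ∷ (0 , 5) ∷ (1 , 6) ∷ (2 , 3) ∷ (2 , 7) ∷ (3 , 4) ∷ (3 , 8) ∷ (4 , 9) ∷ (5 , 7) ∷ (7 , 9) ∷ []
edges₁ = (0 , 1) ∷ (0 , 4) ∷ (1 , 2) ∷ (2 , 3) ∷ (2 , 7) ∷ (3 , 8) ∷ (5 , 8) ∷ (6 , 8) ∷ (6 , 9) ∷ []

G₀ G₁ : Graph 10
G₀ = fromEdges edges₀
G₁ = fromEdges edges₁

split-petersen : PeriodicGraph 10
split-petersen = record { q = 1 ; layers = λ { zero → G₀ ; (suc zero) → G₁ } }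

split-petersen-adj? : ∀ i u v → Dec (Adj (layers split-petersen i) u v)
split-petersen-adj? zero       = edge? edges₀
split-petersen-adj? (suc zero) = edge? edges₁

petersen : Graph 10
petersen = footprint split-petersen

petersen-adj? : ∀ u v → Dec (Adj petersen u v)
petersen-adj? u v = any? λ i → split-petersen-adj? i u v

module Split    = Game split-petersen split-petersen-adj?
module Layer₀   = Game (static G₀) (λ _ → edge? edges₀)
module Layer₁   = Game (static G₁) (λ _ → edge? edges₁)
module Petersen = Game (static petersen) (λ _ → petersen-adj?)

split-petersen-rank : Table split-petersen 1 ℕ
split-petersen-rank =
  ( (1 ∷ 1 ∷ 4 ∷ 15 ∷ 1 ∷ 1 ∷ 11 ∷ 11 ∷ 5 ∷ 11 ∷ [])
    ∷ (1 ∷ 1 ∷ 4 ∷ 15 ∷ 11 ∷ 7 ∷ 1 ∷ 11 ∷ 5 ∷ 9 ∷ [])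
    ∷ (13 ∷ 13 ∷ 1 ∷ 1 ∷ 13 ∷ 13 ∷ 11 ∷ 1 ∷ 2 ∷ 11 ∷ [])
    ∷ (7 ∷ 11 ∷ 1 ∷ 1 ∷ 1 ∷ 13 ∷ 9 ∷ 11 ∷ 1 ∷ 11 ∷ [])
    ∷ (1 ∷ 11 ∷ 3 ∷ 1 ∷ 1 ∷ 13 ∷ 9 ∷ 15 ∷ 2 ∷ 1 ∷ [])
    ∷ (1 ∷ 11 ∷ 4 ∷ 15 ∷ 11 ∷ 1 ∷ 11 ∷ 1 ∷ 5 ∷ 13 ∷ [])
    ∷ (7 ∷ 1 ∷ 4 ∷ 15 ∷ 11 ∷ 7 ∷ 1 ∷ 11 ∷ 5 ∷ 9 ∷ [])
    ∷ (13 ∷ 13 ∷ 1 ∷ 15 ∷ 13 ∷ 1 ∷ 9 ∷ 1 ∷ 5 ∷ 1 ∷ [])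
    ∷ (13 ∷ 13 ∷ 3 ∷ 1 ∷ 13 ∷ 13 ∷ 9 ∷ 13 ∷ 1 ∷ 11 ∷ [])
    ∷ (7 ∷ 11 ∷ 4 ∷ 15 ∷ 1 ∷ 13 ∷ 9 ∷ 1 ∷ 15 ∷ 1 ∷ [])
    ∷ [])
  ∷ ( (1 ∷ 1 ∷ 16 ∷ 4 ∷ 1 ∷ 6 ∷ 10 ∷ 12 ∷ 14 ∷ 10 ∷ [])
    ∷ (1 ∷ 1 ∷ 1 ∷ 3 ∷ 2 ∷ 6 ∷ 10 ∷ 2 ∷ 14 ∷ 10 ∷ [])
    ∷ (12 ∷ 1 ∷ 1 ∷ 1 ∷ 8 ∷ 6 ∷ 10 ∷ 1 ∷ 14 ∷ 10 ∷ [])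
    ∷ (12 ∷ 12 ∷ 1 ∷ 1 ∷ 8 ∷ 14 ∷ 12 ∷ 2 ∷ 1 ∷ 12 ∷ [])
    ∷ (1 ∷ 5 ∷ 16 ∷ 4 ∷ 1 ∷ 6 ∷ 10 ∷ 12 ∷ 14 ∷ 10 ∷ [])
    ∷ (12 ∷ 12 ∷ 14 ∷ 4 ∷ 12 ∷ 1 ∷ 12 ∷ 5 ∷ 1 ∷ 12 ∷ [])
    ∷ (12 ∷ 8 ∷ 14 ∷ 4 ∷ 8 ∷ 8 ∷ 1 ∷ 5 ∷ 1 ∷ 1 ∷ [])
    ∷ (14 ∷ 14 ∷ 1 ∷ 3 ∷ 14 ∷ 6 ∷ 10 ∷ 1 ∷ 14 ∷ 10 ∷ [])
    ∷ (12 ∷ 8 ∷ 12 ∷ 1 ∷ 8 ∷ 1 ∷ 1 ∷ 5 ∷ 1 ∷ 10 ∷ [])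
    ∷ (12 ∷ 8 ∷ 16 ∷ 16 ∷ 8 ∷ 8 ∷ 1 ∷ 5 ∷ 16 ∷ 1 ∷ [])
    ∷ [])
  ∷ []

split-petersen-strategy : Table split-petersen 1 (Config 10 1)
split-petersen-strategy =
  ( ((# 0 ∷ []) ∷ (# 1 ∷ []) ∷ (# 1 ∷ []) ∷ (# 1 ∷ []) ∷ (# 4 ∷ []) ∷ (# 5 ∷ []) ∷ (# 0 ∷ []) ∷ (# 1 ∷ []) ∷ (# 5 ∷ []) ∷ (# 1 ∷ []) ∷ [])
    ∷ ((# 0 ∷ []) ∷ (# 1 ∷ []) ∷ (# 1 ∷ []) ∷ (# 1 ∷ []) ∷ (# 0 ∷ []) ∷ (# 1 ∷ []) ∷ (# 6 ∷ []) ∷ (# 1 ∷ []) ∷ (# 6 ∷ []) ∷ (# 6 ∷ []) ∷ [])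
    ∷ ((# 2 ∷ []) ∷ (# 2 ∷ []) ∷ (# 2 ∷ []) ∷ (# 3 ∷ []) ∷ (# 2 ∷ []) ∷ (# 2 ∷ []) ∷ (# 2 ∷ []) ∷ (# 7 ∷ []) ∷ (# 3 ∷ []) ∷ (# 2 ∷ []) ∷ [])
    ∷ ((# 4 ∷ []) ∷ (# 4 ∷ []) ∷ (# 2 ∷ []) ∷ (# 3 ∷ []) ∷ (# 4 ∷ []) ∷ (# 2 ∷ []) ∷ (# 8 ∷ []) ∷ (# 2 ∷ []) ∷ (# 8 ∷ []) ∷ (# 2 ∷ []) ∷ [])
    ∷ ((# 0 ∷ []) ∷ (# 0 ∷ []) ∷ (# 3 ∷ []) ∷ (# 3 ∷ []) ∷ (# 4 ∷ []) ∷ (# 0 ∷ []) ∷ (# 9 ∷ []) ∷ (# 3 ∷ []) ∷ (# 3 ∷ []) ∷ (# 9 ∷ []) ∷ [])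
    ∷ ((# 0 ∷ []) ∷ (# 0 ∷ []) ∷ (# 7 ∷ []) ∷ (# 5 ∷ []) ∷ (# 0 ∷ []) ∷ (# 5 ∷ []) ∷ (# 0 ∷ []) ∷ (# 7 ∷ []) ∷ (# 5 ∷ []) ∷ (# 0 ∷ []) ∷ [])
    ∷ ((# 1 ∷ []) ∷ (# 1 ∷ []) ∷ (# 1 ∷ []) ∷ (# 1 ∷ []) ∷ (# 1 ∷ []) ∷ (# 1 ∷ []) ∷ (# 6 ∷ []) ∷ (# 1 ∷ []) ∷ (# 6 ∷ []) ∷ (# 6 ∷ []) ∷ [])
    ∷ ((# 2 ∷ []) ∷ (# 2 ∷ []) ∷ (# 2 ∷ []) ∷ (# 2 ∷ []) ∷ (# 2 ∷ []) ∷ (# 5 ∷ []) ∷ (# 9 ∷ []) ∷ (# 7 ∷ []) ∷ (# 5 ∷ []) ∷ (# 9 ∷ []) ∷ [])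
    ∷ ((# 8 ∷ []) ∷ (# 3 ∷ []) ∷ (# 3 ∷ []) ∷ (# 3 ∷ []) ∷ (# 3 ∷ []) ∷ (# 8 ∷ []) ∷ (# 8 ∷ []) ∷ (# 8 ∷ []) ∷ (# 8 ∷ []) ∷ (# 8 ∷ []) ∷ [])
    ∷ ((# 4 ∷ []) ∷ (# 4 ∷ []) ∷ (# 7 ∷ []) ∷ (# 7 ∷ []) ∷ (# 4 ∷ []) ∷ (# 4 ∷ []) ∷ (# 9 ∷ []) ∷ (# 7 ∷ []) ∷ (# 4 ∷ []) ∷ (# 9 ∷ []) ∷ [])
    ∷ [])
  ∷ ( ((# 0 ∷ []) ∷ (# 1 ∷ []) ∷ (# 0 ∷ []) ∷ (# 4 ∷ []) ∷ (# 4 ∷ []) ∷ (# 0 ∷ []) ∷ (# 1 ∷ []) ∷ (# 0 ∷ []) ∷ (# 4 ∷ []) ∷ (# 1 ∷ []) ∷ [])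
    ∷ ((# 0 ∷ []) ∷ (# 1 ∷ []) ∷ (# 2 ∷ []) ∷ (# 2 ∷ []) ∷ (# 0 ∷ []) ∷ (# 0 ∷ []) ∷ (# 1 ∷ []) ∷ (# 2 ∷ []) ∷ (# 2 ∷ []) ∷ (# 1 ∷ []) ∷ [])
    ∷ ((# 1 ∷ []) ∷ (# 1 ∷ []) ∷ (# 2 ∷ []) ∷ (# 3 ∷ []) ∷ (# 3 ∷ []) ∷ (# 7 ∷ []) ∷ (# 1 ∷ []) ∷ (# 7 ∷ []) ∷ (# 2 ∷ []) ∷ (# 1 ∷ []) ∷ [])
    ∷ ((# 3 ∷ []) ∷ (# 3 ∷ []) ∷ (# 2 ∷ []) ∷ (# 3 ∷ []) ∷ (# 3 ∷ []) ∷ (# 2 ∷ []) ∷ (# 2 ∷ []) ∷ (# 2 ∷ []) ∷ (# 8 ∷ []) ∷ (# 2 ∷ []) ∷ [])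
    ∷ ((# 0 ∷ []) ∷ (# 0 ∷ []) ∷ (# 0 ∷ []) ∷ (# 4 ∷ []) ∷ (# 4 ∷ []) ∷ (# 0 ∷ []) ∷ (# 4 ∷ []) ∷ (# 0 ∷ []) ∷ (# 4 ∷ []) ∷ (# 4 ∷ []) ∷ [])
    ∷ ((# 5 ∷ []) ∷ (# 5 ∷ []) ∷ (# 8 ∷ []) ∷ (# 8 ∷ []) ∷ (# 5 ∷ []) ∷ (# 5 ∷ []) ∷ (# 8 ∷ []) ∷ (# 5 ∷ []) ∷ (# 8 ∷ []) ∷ (# 8 ∷ []) ∷ [])
    ∷ ((# 6 ∷ []) ∷ (# 6 ∷ []) ∷ (# 8 ∷ []) ∷ (# 8 ∷ []) ∷ (# 9 ∷ []) ∷ (# 6 ∷ []) ∷ (# 6 ∷ []) ∷ (# 9 ∷ []) ∷ (# 8 ∷ []) ∷ (# 9 ∷ []) ∷ [])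
    ∷ ((# 2 ∷ []) ∷ (# 2 ∷ []) ∷ (# 2 ∷ []) ∷ (# 2 ∷ []) ∷ (# 2 ∷ []) ∷ (# 7 ∷ []) ∷ (# 7 ∷ []) ∷ (# 7 ∷ []) ∷ (# 2 ∷ []) ∷ (# 7 ∷ []) ∷ [])
    ∷ ((# 3 ∷ []) ∷ (# 6 ∷ []) ∷ (# 3 ∷ []) ∷ (# 3 ∷ []) ∷ (# 3 ∷ []) ∷ (# 5 ∷ []) ∷ (# 6 ∷ []) ∷ (# 5 ∷ []) ∷ (# 8 ∷ []) ∷ (# 6 ∷ []) ∷ [])
    ∷ ((# 6 ∷ []) ∷ (# 6 ∷ []) ∷ (# 6 ∷ []) ∷ (# 6 ∷ []) ∷ (# 9 ∷ []) ∷ (# 6 ∷ []) ∷ (# 6 ∷ []) ∷ (# 9 ∷ []) ∷ (# 6 ∷ []) ∷ (# 9 ∷ []) ∷ [])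
    ∷ [])
  ∷ []

G₀-rank : Table (static G₀) 2 ℕ
G₀-rank =
  ( ( (1 ∷ 1 ∷ 3 ∷ 3 ∷ 1 ∷ 1 ∷ 2 ∷ 3 ∷ 3 ∷ 2 ∷ [])
      ∷ (1 ∷ 1 ∷ 4 ∷ 3 ∷ 1 ∷ 1 ∷ 1 ∷ 3 ∷ 3 ∷ 3 ∷ [])
      ∷ (1 ∷ 1 ∷ 1 ∷ 1 ∷ 1 ∷ 1 ∷ 2 ∷ 1 ∷ 2 ∷ 2 ∷ [])
      ∷ (1 ∷ 1 ∷ 1 ∷ 1 ∷ 1 ∷ 1 ∷ 2 ∷ 3 ∷ 1 ∷ 2 ∷ [])
      ∷ (1 ∷ 1 ∷ 2 ∷ 1 ∷ 1 ∷ 1 ∷ 2 ∷ 3 ∷ 2 ∷ 1 ∷ [])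
      ∷ (1 ∷ 1 ∷ 2 ∷ 3 ∷ 1 ∷ 1 ∷ 2 ∷ 1 ∷ 3 ∷ 2 ∷ [])
      ∷ (1 ∷ 1 ∷ 5 ∷ 5 ∷ 1 ∷ 1 ∷ 1 ∷ 5 ∷ 3 ∷ 4 ∷ [])
      ∷ (1 ∷ 1 ∷ 1 ∷ 3 ∷ 1 ∷ 1 ∷ 2 ∷ 1 ∷ 3 ∷ 1 ∷ [])
      ∷ (1 ∷ 1 ∷ 2 ∷ 1 ∷ 1 ∷ 1 ∷ 2 ∷ 3 ∷ 1 ∷ 3 ∷ [])
      ∷ (1 ∷ 1 ∷ 2 ∷ 3 ∷ 1 ∷ 1 ∷ 2 ∷ 1 ∷ 3 ∷ 1 ∷ [])
      ∷ [])
    ∷ ( (1 ∷ 1 ∷ 4 ∷ 3 ∷ 1 ∷ 1 ∷ 1 ∷ 3 ∷ 3 ∷ 3 ∷ [])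
      ∷ (1 ∷ 1 ∷ 4 ∷ 4 ∷ 4 ∷ 4 ∷ 1 ∷ 4 ∷ 4 ∷ 4 ∷ [])
      ∷ (1 ∷ 1 ∷ 1 ∷ 1 ∷ 3 ∷ 2 ∷ 1 ∷ 1 ∷ 2 ∷ 2 ∷ [])
      ∷ (1 ∷ 1 ∷ 1 ∷ 1 ∷ 1 ∷ 2 ∷ 1 ∷ 3 ∷ 1 ∷ 3 ∷ [])
      ∷ (1 ∷ 1 ∷ 4 ∷ 1 ∷ 1 ∷ 2 ∷ 1 ∷ 3 ∷ 2 ∷ 1 ∷ [])
      ∷ (1 ∷ 1 ∷ 4 ∷ 4 ∷ 4 ∷ 1 ∷ 1 ∷ 1 ∷ 4 ∷ 2 ∷ [])
      ∷ (1 ∷ 1 ∷ 5 ∷ 5 ∷ 4 ∷ 4 ∷ 1 ∷ 5 ∷ 4 ∷ 4 ∷ [])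
      ∷ (1 ∷ 1 ∷ 1 ∷ 3 ∷ 3 ∷ 1 ∷ 1 ∷ 1 ∷ 3 ∷ 1 ∷ [])
      ∷ (1 ∷ 1 ∷ 4 ∷ 1 ∷ 3 ∷ 4 ∷ 1 ∷ 4 ∷ 1 ∷ 4 ∷ [])
      ∷ (1 ∷ 1 ∷ 4 ∷ 3 ∷ 1 ∷ 2 ∷ 1 ∷ 1 ∷ 3 ∷ 1 ∷ [])
      ∷ [])
    ∷ ( (1 ∷ 1 ∷ 1 ∷ 1 ∷ 1 ∷ 1 ∷ 2 ∷ 1 ∷ 2 ∷ 2 ∷ [])
      ∷ (1 ∷ 1 ∷ 1 ∷ 1 ∷ 3 ∷ 2 ∷ 1 ∷ 1 ∷ 2 ∷ 2 ∷ [])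
      ∷ (5 ∷ 5 ∷ 1 ∷ 1 ∷ 5 ∷ 5 ∷ 5 ∷ 1 ∷ 2 ∷ 2 ∷ [])
      ∷ (4 ∷ 4 ∷ 1 ∷ 1 ∷ 1 ∷ 2 ∷ 4 ∷ 1 ∷ 1 ∷ 2 ∷ [])
      ∷ (1 ∷ 3 ∷ 1 ∷ 1 ∷ 1 ∷ 2 ∷ 3 ∷ 1 ∷ 2 ∷ 1 ∷ [])
      ∷ (1 ∷ 3 ∷ 1 ∷ 1 ∷ 3 ∷ 1 ∷ 3 ∷ 1 ∷ 2 ∷ 2 ∷ [])
      ∷ (3 ∷ 1 ∷ 1 ∷ 1 ∷ 4 ∷ 2 ∷ 1 ∷ 1 ∷ 2 ∷ 4 ∷ [])
      ∷ (4 ∷ 4 ∷ 1 ∷ 1 ∷ 3 ∷ 1 ∷ 4 ∷ 1 ∷ 2 ∷ 1 ∷ [])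
      ∷ (5 ∷ 5 ∷ 1 ∷ 1 ∷ 5 ∷ 5 ∷ 5 ∷ 1 ∷ 1 ∷ 2 ∷ [])
      ∷ (4 ∷ 4 ∷ 1 ∷ 1 ∷ 1 ∷ 2 ∷ 4 ∷ 1 ∷ 2 ∷ 1 ∷ [])
      ∷ [])
    ∷ ( (1 ∷ 1 ∷ 1 ∷ 1 ∷ 1 ∷ 1 ∷ 2 ∷ 3 ∷ 1 ∷ 2 ∷ [])
      ∷ (1 ∷ 1 ∷ 1 ∷ 1 ∷ 1 ∷ 2 ∷ 1 ∷ 3 ∷ 1 ∷ 3 ∷ [])
      ∷ (4 ∷ 4 ∷ 1 ∷ 1 ∷ 1 ∷ 2 ∷ 4 ∷ 1 ∷ 1 ∷ 2 ∷ [])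
      ∷ (4 ∷ 4 ∷ 1 ∷ 1 ∷ 1 ∷ 3 ∷ 4 ∷ 3 ∷ 1 ∷ 2 ∷ [])
      ∷ (1 ∷ 3 ∷ 1 ∷ 1 ∷ 1 ∷ 2 ∷ 3 ∷ 3 ∷ 1 ∷ 1 ∷ [])
      ∷ (1 ∷ 3 ∷ 1 ∷ 1 ∷ 1 ∷ 1 ∷ 3 ∷ 1 ∷ 1 ∷ 2 ∷ [])
      ∷ (3 ∷ 1 ∷ 1 ∷ 1 ∷ 1 ∷ 3 ∷ 1 ∷ 3 ∷ 1 ∷ 4 ∷ [])
      ∷ (4 ∷ 4 ∷ 1 ∷ 1 ∷ 1 ∷ 1 ∷ 4 ∷ 1 ∷ 1 ∷ 1 ∷ [])
      ∷ (4 ∷ 4 ∷ 1 ∷ 1 ∷ 1 ∷ 4 ∷ 4 ∷ 3 ∷ 1 ∷ 3 ∷ [])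
      ∷ (4 ∷ 4 ∷ 1 ∷ 1 ∷ 1 ∷ 2 ∷ 4 ∷ 1 ∷ 1 ∷ 1 ∷ [])
      ∷ [])
    ∷ ( (1 ∷ 1 ∷ 2 ∷ 1 ∷ 1 ∷ 1 ∷ 2 ∷ 3 ∷ 2 ∷ 1 ∷ [])
      ∷ (1 ∷ 1 ∷ 4 ∷ 1 ∷ 1 ∷ 2 ∷ 1 ∷ 3 ∷ 2 ∷ 1 ∷ [])
      ∷ (1 ∷ 3 ∷ 1 ∷ 1 ∷ 1 ∷ 2 ∷ 3 ∷ 1 ∷ 2 ∷ 1 ∷ [])
      ∷ (1 ∷ 3 ∷ 1 ∷ 1 ∷ 1 ∷ 2 ∷ 3 ∷ 3 ∷ 1 ∷ 1 ∷ [])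
      ∷ (1 ∷ 3 ∷ 2 ∷ 1 ∷ 1 ∷ 2 ∷ 3 ∷ 3 ∷ 2 ∷ 1 ∷ [])
      ∷ (1 ∷ 3 ∷ 2 ∷ 1 ∷ 1 ∷ 1 ∷ 3 ∷ 1 ∷ 2 ∷ 1 ∷ [])
      ∷ (1 ∷ 1 ∷ 4 ∷ 1 ∷ 1 ∷ 3 ∷ 1 ∷ 4 ∷ 2 ∷ 1 ∷ [])
      ∷ (1 ∷ 3 ∷ 1 ∷ 1 ∷ 1 ∷ 1 ∷ 3 ∷ 1 ∷ 2 ∷ 1 ∷ [])
      ∷ (1 ∷ 3 ∷ 2 ∷ 1 ∷ 1 ∷ 4 ∷ 3 ∷ 3 ∷ 1 ∷ 1 ∷ [])
      ∷ (1 ∷ 3 ∷ 2 ∷ 1 ∷ 1 ∷ 2 ∷ 3 ∷ 1 ∷ 2 ∷ 1 ∷ [])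
      ∷ [])
    ∷ ( (1 ∷ 1 ∷ 2 ∷ 3 ∷ 1 ∷ 1 ∷ 2 ∷ 1 ∷ 3 ∷ 2 ∷ [])
      ∷ (1 ∷ 1 ∷ 4 ∷ 4 ∷ 4 ∷ 1 ∷ 1 ∷ 1 ∷ 4 ∷ 2 ∷ [])
      ∷ (1 ∷ 3 ∷ 1 ∷ 1 ∷ 3 ∷ 1 ∷ 3 ∷ 1 ∷ 2 ∷ 2 ∷ [])
      ∷ (1 ∷ 3 ∷ 1 ∷ 1 ∷ 1 ∷ 1 ∷ 3 ∷ 1 ∷ 1 ∷ 2 ∷ [])
      ∷ (1 ∷ 3 ∷ 2 ∷ 1 ∷ 1 ∷ 1 ∷ 3 ∷ 1 ∷ 2 ∷ 1 ∷ [])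
      ∷ (1 ∷ 3 ∷ 4 ∷ 4 ∷ 4 ∷ 1 ∷ 3 ∷ 1 ∷ 4 ∷ 2 ∷ [])
      ∷ (1 ∷ 1 ∷ 4 ∷ 4 ∷ 4 ∷ 1 ∷ 1 ∷ 1 ∷ 4 ∷ 4 ∷ [])
      ∷ (1 ∷ 3 ∷ 1 ∷ 3 ∷ 3 ∷ 1 ∷ 3 ∷ 1 ∷ 3 ∷ 1 ∷ [])
      ∷ (1 ∷ 3 ∷ 2 ∷ 1 ∷ 3 ∷ 1 ∷ 3 ∷ 1 ∷ 1 ∷ 2 ∷ [])
      ∷ (1 ∷ 3 ∷ 2 ∷ 3 ∷ 1 ∷ 1 ∷ 3 ∷ 1 ∷ 3 ∷ 1 ∷ [])
      ∷ [])
    ∷ ( (1 ∷ 1 ∷ 5 ∷ 5 ∷ 1 ∷ 1 ∷ 1 ∷ 5 ∷ 3 ∷ 4 ∷ [])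
      ∷ (1 ∷ 1 ∷ 5 ∷ 5 ∷ 4 ∷ 4 ∷ 1 ∷ 5 ∷ 4 ∷ 4 ∷ [])
      ∷ (3 ∷ 1 ∷ 1 ∷ 1 ∷ 4 ∷ 2 ∷ 1 ∷ 1 ∷ 2 ∷ 4 ∷ [])
      ∷ (3 ∷ 1 ∷ 1 ∷ 1 ∷ 1 ∷ 3 ∷ 1 ∷ 3 ∷ 1 ∷ 4 ∷ [])
      ∷ (1 ∷ 1 ∷ 4 ∷ 1 ∷ 1 ∷ 3 ∷ 1 ∷ 4 ∷ 2 ∷ 1 ∷ [])
      ∷ (1 ∷ 1 ∷ 4 ∷ 4 ∷ 4 ∷ 1 ∷ 1 ∷ 1 ∷ 4 ∷ 4 ∷ [])
      ∷ (5 ∷ 1 ∷ 5 ∷ 5 ∷ 5 ∷ 5 ∷ 1 ∷ 5 ∷ 5 ∷ 5 ∷ [])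
      ∷ (3 ∷ 1 ∷ 1 ∷ 4 ∷ 4 ∷ 1 ∷ 1 ∷ 1 ∷ 3 ∷ 1 ∷ [])
      ∷ (3 ∷ 1 ∷ 4 ∷ 1 ∷ 4 ∷ 4 ∷ 1 ∷ 4 ∷ 1 ∷ 4 ∷ [])
      ∷ (3 ∷ 1 ∷ 4 ∷ 4 ∷ 1 ∷ 2 ∷ 1 ∷ 1 ∷ 3 ∷ 1 ∷ [])
      ∷ [])
    ∷ ( (1 ∷ 1 ∷ 1 ∷ 3 ∷ 1 ∷ 1 ∷ 2 ∷ 1 ∷ 3 ∷ 1 ∷ [])
      ∷ (1 ∷ 1 ∷ 1 ∷ 3 ∷ 3 ∷ 1 ∷ 1 ∷ 1 ∷ 3 ∷ 1 ∷ [])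
      ∷ (4 ∷ 4 ∷ 1 ∷ 1 ∷ 3 ∷ 1 ∷ 4 ∷ 1 ∷ 2 ∷ 1 ∷ [])
      ∷ (4 ∷ 4 ∷ 1 ∷ 1 ∷ 1 ∷ 1 ∷ 4 ∷ 1 ∷ 1 ∷ 1 ∷ [])
      ∷ (1 ∷ 3 ∷ 1 ∷ 1 ∷ 1 ∷ 1 ∷ 3 ∷ 1 ∷ 2 ∷ 1 ∷ [])
      ∷ (1 ∷ 3 ∷ 1 ∷ 3 ∷ 3 ∷ 1 ∷ 3 ∷ 1 ∷ 3 ∷ 1 ∷ [])
      ∷ (3 ∷ 1 ∷ 1 ∷ 4 ∷ 4 ∷ 1 ∷ 1 ∷ 1 ∷ 3 ∷ 1 ∷ [])
      ∷ (4 ∷ 4 ∷ 1 ∷ 3 ∷ 4 ∷ 1 ∷ 4 ∷ 1 ∷ 3 ∷ 1 ∷ [])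
      ∷ (4 ∷ 4 ∷ 1 ∷ 1 ∷ 3 ∷ 1 ∷ 4 ∷ 1 ∷ 1 ∷ 1 ∷ [])
      ∷ (4 ∷ 4 ∷ 1 ∷ 3 ∷ 1 ∷ 1 ∷ 4 ∷ 1 ∷ 3 ∷ 1 ∷ [])
      ∷ [])
    ∷ ( (1 ∷ 1 ∷ 2 ∷ 1 ∷ 1 ∷ 1 ∷ 2 ∷ 3 ∷ 1 ∷ 3 ∷ [])
      ∷ (1 ∷ 1 ∷ 4 ∷ 1 ∷ 3 ∷ 4 ∷ 1 ∷ 4 ∷ 1 ∷ 4 ∷ [])
      ∷ (5 ∷ 5 ∷ 1 ∷ 1 ∷ 5 ∷ 5 ∷ 5 ∷ 1 ∷ 1 ∷ 2 ∷ [])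
      ∷ (4 ∷ 4 ∷ 1 ∷ 1 ∷ 1 ∷ 4 ∷ 4 ∷ 3 ∷ 1 ∷ 3 ∷ [])
      ∷ (1 ∷ 3 ∷ 2 ∷ 1 ∷ 1 ∷ 4 ∷ 3 ∷ 3 ∷ 1 ∷ 1 ∷ [])
      ∷ (1 ∷ 3 ∷ 2 ∷ 1 ∷ 3 ∷ 1 ∷ 3 ∷ 1 ∷ 1 ∷ 2 ∷ [])
      ∷ (3 ∷ 1 ∷ 4 ∷ 1 ∷ 4 ∷ 4 ∷ 1 ∷ 4 ∷ 1 ∷ 4 ∷ [])
      ∷ (4 ∷ 4 ∷ 1 ∷ 1 ∷ 3 ∷ 1 ∷ 4 ∷ 1 ∷ 1 ∷ 1 ∷ [])
      ∷ (5 ∷ 5 ∷ 4 ∷ 1 ∷ 5 ∷ 5 ∷ 5 ∷ 4 ∷ 1 ∷ 4 ∷ [])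
      ∷ (4 ∷ 4 ∷ 2 ∷ 1 ∷ 1 ∷ 4 ∷ 4 ∷ 1 ∷ 1 ∷ 1 ∷ [])
      ∷ [])
    ∷ ( (1 ∷ 1 ∷ 2 ∷ 3 ∷ 1 ∷ 1 ∷ 2 ∷ 1 ∷ 3 ∷ 1 ∷ [])
      ∷ (1 ∷ 1 ∷ 4 ∷ 3 ∷ 1 ∷ 2 ∷ 1 ∷ 1 ∷ 3 ∷ 1 ∷ [])
      ∷ (4 ∷ 4 ∷ 1 ∷ 1 ∷ 1 ∷ 2 ∷ 4 ∷ 1 ∷ 2 ∷ 1 ∷ [])
      ∷ (4 ∷ 4 ∷ 1 ∷ 1 ∷ 1 ∷ 2 ∷ 4 ∷ 1 ∷ 1 ∷ 1 ∷ [])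
      ∷ (1 ∷ 3 ∷ 2 ∷ 1 ∷ 1 ∷ 2 ∷ 3 ∷ 1 ∷ 2 ∷ 1 ∷ [])
      ∷ (1 ∷ 3 ∷ 2 ∷ 3 ∷ 1 ∷ 1 ∷ 3 ∷ 1 ∷ 3 ∷ 1 ∷ [])
      ∷ (3 ∷ 1 ∷ 4 ∷ 4 ∷ 1 ∷ 2 ∷ 1 ∷ 1 ∷ 3 ∷ 1 ∷ [])
      ∷ (4 ∷ 4 ∷ 1 ∷ 3 ∷ 1 ∷ 1 ∷ 4 ∷ 1 ∷ 3 ∷ 1 ∷ [])
      ∷ (4 ∷ 4 ∷ 2 ∷ 1 ∷ 1 ∷ 4 ∷ 4 ∷ 1 ∷ 1 ∷ 1 ∷ [])
      ∷ (4 ∷ 4 ∷ 2 ∷ 3 ∷ 1 ∷ 2 ∷ 4 ∷ 1 ∷ 3 ∷ 1 ∷ [])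
      ∷ [])
    ∷ [])
  ∷ []

G₀-strategy : Table (static G₀) 2 (Config 10 2)
G₀-strategy =
  ( ( ((# 0 ∷ # 0 ∷ []) ∷ (# 0 ∷ # 1 ∷ []) ∷ (# 4 ∷ # 5 ∷ []) ∷ (# 0 ∷ # 4 ∷ []) ∷ (# 0 ∷ # 4 ∷ []) ∷ (# 0 ∷ # 5 ∷ []) ∷ (# 0 ∷ # 1 ∷ []) ∷ (# 0 ∷ # 5 ∷ []) ∷ (# 0 ∷ # 4 ∷ []) ∷ (# 4 ∷ # 5 ∷ []) ∷ [])
      ∷ ((# 0 ∷ # 0 ∷ []) ∷ (# 0 ∷ # 1 ∷ []) ∷ (# 0 ∷ # 0 ∷ []) ∷ (# 4 ∷ # 0 ∷ []) ∷ (# 4 ∷ # 0 ∷ []) ∷ (# 5 ∷ # 0 ∷ []) ∷ (# 0 ∷ # 6 ∷ []) ∷ (# 5 ∷ # 0 ∷ []) ∷ (# 4 ∷ # 0 ∷ []) ∷ (# 5 ∷ # 0 ∷ []) ∷ [])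
      ∷ ((# 0 ∷ # 2 ∷ []) ∷ (# 1 ∷ # 2 ∷ []) ∷ (# 0 ∷ # 2 ∷ []) ∷ (# 0 ∷ # 3 ∷ []) ∷ (# 4 ∷ # 2 ∷ []) ∷ (# 5 ∷ # 2 ∷ []) ∷ (# 1 ∷ # 2 ∷ []) ∷ (# 0 ∷ # 7 ∷ []) ∷ (# 0 ∷ # 3 ∷ []) ∷ (# 0 ∷ # 7 ∷ []) ∷ [])
      ∷ ((# 0 ∷ # 2 ∷ []) ∷ (# 1 ∷ # 2 ∷ []) ∷ (# 0 ∷ # 2 ∷ []) ∷ (# 0 ∷ # 3 ∷ []) ∷ (# 0 ∷ # 4 ∷ []) ∷ (# 5 ∷ # 2 ∷ []) ∷ (# 1 ∷ # 2 ∷ []) ∷ (# 0 ∷ # 2 ∷ []) ∷ (# 0 ∷ # 8 ∷ []) ∷ (# 4 ∷ # 2 ∷ []) ∷ [])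
      ∷ ((# 0 ∷ # 0 ∷ []) ∷ (# 1 ∷ # 0 ∷ []) ∷ (# 5 ∷ # 3 ∷ []) ∷ (# 0 ∷ # 3 ∷ []) ∷ (# 0 ∷ # 4 ∷ []) ∷ (# 5 ∷ # 0 ∷ []) ∷ (# 1 ∷ # 0 ∷ []) ∷ (# 0 ∷ # 9 ∷ []) ∷ (# 0 ∷ # 3 ∷ []) ∷ (# 0 ∷ # 9 ∷ []) ∷ [])
      ∷ ((# 0 ∷ # 0 ∷ []) ∷ (# 1 ∷ # 0 ∷ []) ∷ (# 4 ∷ # 7 ∷ []) ∷ (# 4 ∷ # 0 ∷ []) ∷ (# 4 ∷ # 0 ∷ []) ∷ (# 0 ∷ # 5 ∷ []) ∷ (# 1 ∷ # 0 ∷ []) ∷ (# 0 ∷ # 7 ∷ []) ∷ (# 4 ∷ # 0 ∷ []) ∷ (# 0 ∷ # 7 ∷ []) ∷ [])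
      ∷ ((# 0 ∷ # 1 ∷ []) ∷ (# 0 ∷ # 1 ∷ []) ∷ (# 0 ∷ # 1 ∷ []) ∷ (# 0 ∷ # 1 ∷ []) ∷ (# 4 ∷ # 1 ∷ []) ∷ (# 5 ∷ # 1 ∷ []) ∷ (# 0 ∷ # 6 ∷ []) ∷ (# 0 ∷ # 1 ∷ []) ∷ (# 4 ∷ # 1 ∷ []) ∷ (# 0 ∷ # 1 ∷ []) ∷ [])
      ∷ ((# 0 ∷ # 2 ∷ []) ∷ (# 1 ∷ # 2 ∷ []) ∷ (# 0 ∷ # 2 ∷ []) ∷ (# 0 ∷ # 2 ∷ []) ∷ (# 4 ∷ # 2 ∷ []) ∷ (# 0 ∷ # 5 ∷ []) ∷ (# 1 ∷ # 2 ∷ []) ∷ (# 0 ∷ # 7 ∷ []) ∷ (# 0 ∷ # 2 ∷ []) ∷ (# 0 ∷ # 9 ∷ []) ∷ [])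
      ∷ ((# 0 ∷ # 3 ∷ []) ∷ (# 1 ∷ # 3 ∷ []) ∷ (# 5 ∷ # 3 ∷ []) ∷ (# 0 ∷ # 3 ∷ []) ∷ (# 4 ∷ # 3 ∷ []) ∷ (# 5 ∷ # 3 ∷ []) ∷ (# 1 ∷ # 3 ∷ []) ∷ (# 5 ∷ # 3 ∷ []) ∷ (# 0 ∷ # 8 ∷ []) ∷ (# 5 ∷ # 3 ∷ []) ∷ [])
      ∷ ((# 0 ∷ # 4 ∷ []) ∷ (# 1 ∷ # 4 ∷ []) ∷ (# 4 ∷ # 7 ∷ []) ∷ (# 0 ∷ # 4 ∷ []) ∷ (# 0 ∷ # 4 ∷ []) ∷ (# 5 ∷ # 4 ∷ []) ∷ (# 1 ∷ # 4 ∷ []) ∷ (# 0 ∷ # 7 ∷ []) ∷ (# 0 ∷ # 4 ∷ []) ∷ (# 0 ∷ # 9 ∷ []) ∷ [])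
      ∷ [])
    ∷ ( ((# 0 ∷ # 0 ∷ []) ∷ (# 0 ∷ # 1 ∷ []) ∷ (# 0 ∷ # 0 ∷ []) ∷ (# 0 ∷ # 4 ∷ []) ∷ (# 0 ∷ # 4 ∷ []) ∷ (# 0 ∷ # 5 ∷ []) ∷ (# 6 ∷ # 0 ∷ []) ∷ (# 0 ∷ # 5 ∷ []) ∷ (# 0 ∷ # 4 ∷ []) ∷ (# 0 ∷ # 5 ∷ []) ∷ [])
      ∷ ((# 0 ∷ # 0 ∷ []) ∷ (# 0 ∷ # 1 ∷ []) ∷ (# 0 ∷ # 0 ∷ []) ∷ (# 0 ∷ # 0 ∷ []) ∷ (# 0 ∷ # 0 ∷ []) ∷ (# 0 ∷ # 0 ∷ []) ∷ (# 0 ∷ # 6 ∷ []) ∷ (# 0 ∷ # 0 ∷ []) ∷ (# 0 ∷ # 0 ∷ []) ∷ (# 0 ∷ # 0 ∷ []) ∷ [])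
      ∷ ((# 0 ∷ # 2 ∷ []) ∷ (# 1 ∷ # 2 ∷ []) ∷ (# 0 ∷ # 2 ∷ []) ∷ (# 0 ∷ # 3 ∷ []) ∷ (# 0 ∷ # 2 ∷ []) ∷ (# 0 ∷ # 2 ∷ []) ∷ (# 6 ∷ # 2 ∷ []) ∷ (# 0 ∷ # 7 ∷ []) ∷ (# 0 ∷ # 3 ∷ []) ∷ (# 0 ∷ # 7 ∷ []) ∷ [])
      ∷ ((# 0 ∷ # 2 ∷ []) ∷ (# 1 ∷ # 2 ∷ []) ∷ (# 0 ∷ # 2 ∷ []) ∷ (# 0 ∷ # 3 ∷ []) ∷ (# 0 ∷ # 4 ∷ []) ∷ (# 0 ∷ # 2 ∷ []) ∷ (# 6 ∷ # 2 ∷ []) ∷ (# 0 ∷ # 2 ∷ []) ∷ (# 0 ∷ # 8 ∷ []) ∷ (# 0 ∷ # 2 ∷ []) ∷ [])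
      ∷ ((# 0 ∷ # 0 ∷ []) ∷ (# 1 ∷ # 0 ∷ []) ∷ (# 0 ∷ # 0 ∷ []) ∷ (# 0 ∷ # 3 ∷ []) ∷ (# 0 ∷ # 4 ∷ []) ∷ (# 0 ∷ # 9 ∷ []) ∷ (# 6 ∷ # 0 ∷ []) ∷ (# 0 ∷ # 9 ∷ []) ∷ (# 0 ∷ # 3 ∷ []) ∷ (# 0 ∷ # 9 ∷ []) ∷ [])
      ∷ ((# 0 ∷ # 0 ∷ []) ∷ (# 1 ∷ # 0 ∷ []) ∷ (# 0 ∷ # 0 ∷ []) ∷ (# 0 ∷ # 0 ∷ []) ∷ (# 0 ∷ # 0 ∷ []) ∷ (# 0 ∷ # 5 ∷ []) ∷ (# 6 ∷ # 0 ∷ []) ∷ (# 0 ∷ # 7 ∷ []) ∷ (# 0 ∷ # 0 ∷ []) ∷ (# 0 ∷ # 7 ∷ []) ∷ [])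
      ∷ ((# 0 ∷ # 1 ∷ []) ∷ (# 0 ∷ # 1 ∷ []) ∷ (# 0 ∷ # 1 ∷ []) ∷ (# 0 ∷ # 1 ∷ []) ∷ (# 0 ∷ # 1 ∷ []) ∷ (# 0 ∷ # 1 ∷ []) ∷ (# 0 ∷ # 6 ∷ []) ∷ (# 0 ∷ # 1 ∷ []) ∷ (# 0 ∷ # 1 ∷ []) ∷ (# 0 ∷ # 1 ∷ []) ∷ [])
      ∷ ((# 0 ∷ # 2 ∷ []) ∷ (# 1 ∷ # 2 ∷ []) ∷ (# 0 ∷ # 2 ∷ []) ∷ (# 0 ∷ # 2 ∷ []) ∷ (# 0 ∷ # 2 ∷ []) ∷ (# 0 ∷ # 5 ∷ []) ∷ (# 6 ∷ # 2 ∷ []) ∷ (# 0 ∷ # 7 ∷ []) ∷ (# 0 ∷ # 2 ∷ []) ∷ (# 0 ∷ # 9 ∷ []) ∷ [])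
      ∷ ((# 0 ∷ # 3 ∷ []) ∷ (# 1 ∷ # 3 ∷ []) ∷ (# 0 ∷ # 3 ∷ []) ∷ (# 0 ∷ # 3 ∷ []) ∷ (# 0 ∷ # 3 ∷ []) ∷ (# 0 ∷ # 3 ∷ []) ∷ (# 6 ∷ # 3 ∷ []) ∷ (# 0 ∷ # 3 ∷ []) ∷ (# 0 ∷ # 8 ∷ []) ∷ (# 0 ∷ # 3 ∷ []) ∷ [])
      ∷ ((# 0 ∷ # 4 ∷ []) ∷ (# 1 ∷ # 4 ∷ []) ∷ (# 0 ∷ # 4 ∷ []) ∷ (# 0 ∷ # 4 ∷ []) ∷ (# 0 ∷ # 4 ∷ []) ∷ (# 0 ∷ # 7 ∷ []) ∷ (# 6 ∷ # 4 ∷ []) ∷ (# 0 ∷ # 7 ∷ []) ∷ (# 0 ∷ # 4 ∷ []) ∷ (# 0 ∷ # 9 ∷ []) ∷ [])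
      ∷ [])
    ∷ ( ((# 2 ∷ # 0 ∷ []) ∷ (# 2 ∷ # 1 ∷ []) ∷ (# 2 ∷ # 0 ∷ []) ∷ (# 3 ∷ # 0 ∷ []) ∷ (# 2 ∷ # 4 ∷ []) ∷ (# 2 ∷ # 5 ∷ []) ∷ (# 2 ∷ # 1 ∷ []) ∷ (# 7 ∷ # 0 ∷ []) ∷ (# 3 ∷ # 0 ∷ []) ∷ (# 2 ∷ # 4 ∷ []) ∷ [])
      ∷ ((# 2 ∷ # 0 ∷ []) ∷ (# 2 ∷ # 1 ∷ []) ∷ (# 2 ∷ # 0 ∷ []) ∷ (# 3 ∷ # 0 ∷ []) ∷ (# 2 ∷ # 0 ∷ []) ∷ (# 2 ∷ # 0 ∷ []) ∷ (# 2 ∷ # 6 ∷ []) ∷ (# 7 ∷ # 0 ∷ []) ∷ (# 3 ∷ # 0 ∷ []) ∷ (# 7 ∷ # 0 ∷ []) ∷ [])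
      ∷ ((# 2 ∷ # 3 ∷ []) ∷ (# 2 ∷ # 3 ∷ []) ∷ (# 2 ∷ # 2 ∷ []) ∷ (# 2 ∷ # 3 ∷ []) ∷ (# 2 ∷ # 3 ∷ []) ∷ (# 2 ∷ # 3 ∷ []) ∷ (# 2 ∷ # 3 ∷ []) ∷ (# 2 ∷ # 7 ∷ []) ∷ (# 2 ∷ # 3 ∷ []) ∷ (# 3 ∷ # 7 ∷ []) ∷ [])
      ∷ ((# 2 ∷ # 4 ∷ []) ∷ (# 2 ∷ # 4 ∷ []) ∷ (# 2 ∷ # 2 ∷ []) ∷ (# 2 ∷ # 3 ∷ []) ∷ (# 2 ∷ # 4 ∷ []) ∷ (# 7 ∷ # 4 ∷ []) ∷ (# 2 ∷ # 4 ∷ []) ∷ (# 7 ∷ # 2 ∷ []) ∷ (# 2 ∷ # 8 ∷ []) ∷ (# 2 ∷ # 4 ∷ []) ∷ [])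
      ∷ ((# 2 ∷ # 0 ∷ []) ∷ (# 2 ∷ # 0 ∷ []) ∷ (# 2 ∷ # 0 ∷ []) ∷ (# 2 ∷ # 3 ∷ []) ∷ (# 2 ∷ # 4 ∷ []) ∷ (# 2 ∷ # 0 ∷ []) ∷ (# 2 ∷ # 0 ∷ []) ∷ (# 7 ∷ # 0 ∷ []) ∷ (# 2 ∷ # 3 ∷ []) ∷ (# 2 ∷ # 9 ∷ []) ∷ [])
      ∷ ((# 2 ∷ # 0 ∷ []) ∷ (# 2 ∷ # 0 ∷ []) ∷ (# 2 ∷ # 0 ∷ []) ∷ (# 3 ∷ # 0 ∷ []) ∷ (# 2 ∷ # 0 ∷ []) ∷ (# 2 ∷ # 5 ∷ []) ∷ (# 2 ∷ # 0 ∷ []) ∷ (# 2 ∷ # 7 ∷ []) ∷ (# 3 ∷ # 0 ∷ []) ∷ (# 3 ∷ # 7 ∷ []) ∷ [])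
      ∷ ((# 3 ∷ # 1 ∷ []) ∷ (# 2 ∷ # 1 ∷ []) ∷ (# 2 ∷ # 1 ∷ []) ∷ (# 3 ∷ # 1 ∷ []) ∷ (# 2 ∷ # 1 ∷ []) ∷ (# 7 ∷ # 1 ∷ []) ∷ (# 2 ∷ # 6 ∷ []) ∷ (# 7 ∷ # 1 ∷ []) ∷ (# 3 ∷ # 1 ∷ []) ∷ (# 2 ∷ # 1 ∷ []) ∷ [])
      ∷ ((# 2 ∷ # 5 ∷ []) ∷ (# 2 ∷ # 5 ∷ []) ∷ (# 2 ∷ # 2 ∷ []) ∷ (# 3 ∷ # 2 ∷ []) ∷ (# 3 ∷ # 5 ∷ []) ∷ (# 2 ∷ # 5 ∷ []) ∷ (# 2 ∷ # 5 ∷ []) ∷ (# 2 ∷ # 7 ∷ []) ∷ (# 3 ∷ # 2 ∷ []) ∷ (# 2 ∷ # 9 ∷ []) ∷ [])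
      ∷ ((# 2 ∷ # 3 ∷ []) ∷ (# 2 ∷ # 3 ∷ []) ∷ (# 2 ∷ # 3 ∷ []) ∷ (# 2 ∷ # 3 ∷ []) ∷ (# 2 ∷ # 3 ∷ []) ∷ (# 2 ∷ # 3 ∷ []) ∷ (# 2 ∷ # 3 ∷ []) ∷ (# 7 ∷ # 3 ∷ []) ∷ (# 2 ∷ # 8 ∷ []) ∷ (# 7 ∷ # 3 ∷ []) ∷ [])
      ∷ ((# 2 ∷ # 4 ∷ []) ∷ (# 2 ∷ # 4 ∷ []) ∷ (# 2 ∷ # 4 ∷ []) ∷ (# 3 ∷ # 4 ∷ []) ∷ (# 2 ∷ # 4 ∷ []) ∷ (# 7 ∷ # 4 ∷ []) ∷ (# 2 ∷ # 4 ∷ []) ∷ (# 2 ∷ # 7 ∷ []) ∷ (# 3 ∷ # 4 ∷ []) ∷ (# 2 ∷ # 9 ∷ []) ∷ [])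
      ∷ [])
    ∷ ( ((# 2 ∷ # 0 ∷ []) ∷ (# 2 ∷ # 1 ∷ []) ∷ (# 2 ∷ # 0 ∷ []) ∷ (# 3 ∷ # 0 ∷ []) ∷ (# 2 ∷ # 4 ∷ []) ∷ (# 2 ∷ # 5 ∷ []) ∷ (# 2 ∷ # 1 ∷ []) ∷ (# 2 ∷ # 0 ∷ []) ∷ (# 8 ∷ # 0 ∷ []) ∷ (# 2 ∷ # 4 ∷ []) ∷ [])
      ∷ ((# 2 ∷ # 0 ∷ []) ∷ (# 2 ∷ # 1 ∷ []) ∷ (# 2 ∷ # 0 ∷ []) ∷ (# 3 ∷ # 0 ∷ []) ∷ (# 4 ∷ # 0 ∷ []) ∷ (# 2 ∷ # 0 ∷ []) ∷ (# 2 ∷ # 6 ∷ []) ∷ (# 2 ∷ # 0 ∷ []) ∷ (# 8 ∷ # 0 ∷ []) ∷ (# 2 ∷ # 0 ∷ []) ∷ [])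
      ∷ ((# 4 ∷ # 2 ∷ []) ∷ (# 4 ∷ # 2 ∷ []) ∷ (# 2 ∷ # 2 ∷ []) ∷ (# 2 ∷ # 3 ∷ []) ∷ (# 4 ∷ # 2 ∷ []) ∷ (# 4 ∷ # 7 ∷ []) ∷ (# 4 ∷ # 2 ∷ []) ∷ (# 2 ∷ # 7 ∷ []) ∷ (# 8 ∷ # 2 ∷ []) ∷ (# 3 ∷ # 7 ∷ []) ∷ [])
      ∷ ((# 2 ∷ # 4 ∷ []) ∷ (# 2 ∷ # 4 ∷ []) ∷ (# 2 ∷ # 2 ∷ []) ∷ (# 2 ∷ # 3 ∷ []) ∷ (# 2 ∷ # 4 ∷ []) ∷ (# 2 ∷ # 4 ∷ []) ∷ (# 2 ∷ # 4 ∷ []) ∷ (# 2 ∷ # 3 ∷ []) ∷ (# 2 ∷ # 8 ∷ []) ∷ (# 2 ∷ # 4 ∷ []) ∷ [])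
      ∷ ((# 2 ∷ # 0 ∷ []) ∷ (# 2 ∷ # 0 ∷ []) ∷ (# 2 ∷ # 0 ∷ []) ∷ (# 2 ∷ # 3 ∷ []) ∷ (# 2 ∷ # 4 ∷ []) ∷ (# 2 ∷ # 0 ∷ []) ∷ (# 2 ∷ # 0 ∷ []) ∷ (# 2 ∷ # 0 ∷ []) ∷ (# 8 ∷ # 0 ∷ []) ∷ (# 2 ∷ # 9 ∷ []) ∷ [])
      ∷ ((# 2 ∷ # 0 ∷ []) ∷ (# 2 ∷ # 0 ∷ []) ∷ (# 2 ∷ # 0 ∷ []) ∷ (# 3 ∷ # 0 ∷ []) ∷ (# 4 ∷ # 0 ∷ []) ∷ (# 2 ∷ # 5 ∷ []) ∷ (# 2 ∷ # 0 ∷ []) ∷ (# 2 ∷ # 7 ∷ []) ∷ (# 8 ∷ # 0 ∷ []) ∷ (# 3 ∷ # 7 ∷ []) ∷ [])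
      ∷ ((# 3 ∷ # 1 ∷ []) ∷ (# 2 ∷ # 1 ∷ []) ∷ (# 2 ∷ # 1 ∷ []) ∷ (# 3 ∷ # 1 ∷ []) ∷ (# 4 ∷ # 1 ∷ []) ∷ (# 2 ∷ # 1 ∷ []) ∷ (# 2 ∷ # 6 ∷ []) ∷ (# 2 ∷ # 1 ∷ []) ∷ (# 8 ∷ # 1 ∷ []) ∷ (# 2 ∷ # 1 ∷ []) ∷ [])
      ∷ ((# 2 ∷ # 5 ∷ []) ∷ (# 2 ∷ # 5 ∷ []) ∷ (# 2 ∷ # 2 ∷ []) ∷ (# 3 ∷ # 2 ∷ []) ∷ (# 4 ∷ # 2 ∷ []) ∷ (# 2 ∷ # 5 ∷ []) ∷ (# 2 ∷ # 5 ∷ []) ∷ (# 2 ∷ # 7 ∷ []) ∷ (# 8 ∷ # 2 ∷ []) ∷ (# 2 ∷ # 9 ∷ []) ∷ [])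
      ∷ ((# 4 ∷ # 3 ∷ []) ∷ (# 4 ∷ # 3 ∷ []) ∷ (# 2 ∷ # 3 ∷ []) ∷ (# 2 ∷ # 3 ∷ []) ∷ (# 4 ∷ # 3 ∷ []) ∷ (# 4 ∷ # 3 ∷ []) ∷ (# 4 ∷ # 3 ∷ []) ∷ (# 2 ∷ # 3 ∷ []) ∷ (# 2 ∷ # 8 ∷ []) ∷ (# 2 ∷ # 3 ∷ []) ∷ [])
      ∷ ((# 2 ∷ # 4 ∷ []) ∷ (# 2 ∷ # 4 ∷ []) ∷ (# 2 ∷ # 4 ∷ []) ∷ (# 3 ∷ # 4 ∷ []) ∷ (# 2 ∷ # 4 ∷ []) ∷ (# 4 ∷ # 7 ∷ []) ∷ (# 2 ∷ # 4 ∷ []) ∷ (# 2 ∷ # 7 ∷ []) ∷ (# 8 ∷ # 4 ∷ []) ∷ (# 2 ∷ # 9 ∷ []) ∷ [])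
      ∷ [])
    ∷ ( ((# 0 ∷ # 0 ∷ []) ∷ (# 0 ∷ # 1 ∷ []) ∷ (# 3 ∷ # 5 ∷ []) ∷ (# 3 ∷ # 0 ∷ []) ∷ (# 0 ∷ # 4 ∷ []) ∷ (# 0 ∷ # 5 ∷ []) ∷ (# 0 ∷ # 1 ∷ []) ∷ (# 0 ∷ # 5 ∷ []) ∷ (# 3 ∷ # 0 ∷ []) ∷ (# 9 ∷ # 0 ∷ []) ∷ [])
      ∷ ((# 0 ∷ # 0 ∷ []) ∷ (# 0 ∷ # 1 ∷ []) ∷ (# 0 ∷ # 0 ∷ []) ∷ (# 3 ∷ # 0 ∷ []) ∷ (# 4 ∷ # 0 ∷ []) ∷ (# 9 ∷ # 0 ∷ []) ∷ (# 0 ∷ # 6 ∷ []) ∷ (# 9 ∷ # 0 ∷ []) ∷ (# 3 ∷ # 0 ∷ []) ∷ (# 9 ∷ # 0 ∷ []) ∷ [])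
      ∷ ((# 0 ∷ # 2 ∷ []) ∷ (# 0 ∷ # 2 ∷ []) ∷ (# 0 ∷ # 2 ∷ []) ∷ (# 0 ∷ # 3 ∷ []) ∷ (# 4 ∷ # 2 ∷ []) ∷ (# 0 ∷ # 2 ∷ []) ∷ (# 0 ∷ # 2 ∷ []) ∷ (# 0 ∷ # 7 ∷ []) ∷ (# 0 ∷ # 3 ∷ []) ∷ (# 9 ∷ # 2 ∷ []) ∷ [])
      ∷ ((# 0 ∷ # 2 ∷ []) ∷ (# 0 ∷ # 2 ∷ []) ∷ (# 0 ∷ # 2 ∷ []) ∷ (# 0 ∷ # 3 ∷ []) ∷ (# 0 ∷ # 4 ∷ []) ∷ (# 0 ∷ # 2 ∷ []) ∷ (# 0 ∷ # 2 ∷ []) ∷ (# 0 ∷ # 2 ∷ []) ∷ (# 0 ∷ # 8 ∷ []) ∷ (# 9 ∷ # 2 ∷ []) ∷ [])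
      ∷ ((# 0 ∷ # 0 ∷ []) ∷ (# 0 ∷ # 0 ∷ []) ∷ (# 3 ∷ # 9 ∷ []) ∷ (# 0 ∷ # 3 ∷ []) ∷ (# 0 ∷ # 4 ∷ []) ∷ (# 0 ∷ # 9 ∷ []) ∷ (# 0 ∷ # 0 ∷ []) ∷ (# 0 ∷ # 9 ∷ []) ∷ (# 0 ∷ # 3 ∷ []) ∷ (# 0 ∷ # 9 ∷ []) ∷ [])
      ∷ ((# 0 ∷ # 0 ∷ []) ∷ (# 0 ∷ # 0 ∷ []) ∷ (# 3 ∷ # 5 ∷ []) ∷ (# 3 ∷ # 0 ∷ []) ∷ (# 4 ∷ # 0 ∷ []) ∷ (# 0 ∷ # 5 ∷ []) ∷ (# 0 ∷ # 0 ∷ []) ∷ (# 0 ∷ # 7 ∷ []) ∷ (# 3 ∷ # 0 ∷ []) ∷ (# 9 ∷ # 0 ∷ []) ∷ [])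
      ∷ ((# 0 ∷ # 1 ∷ []) ∷ (# 0 ∷ # 1 ∷ []) ∷ (# 3 ∷ # 1 ∷ []) ∷ (# 3 ∷ # 1 ∷ []) ∷ (# 4 ∷ # 1 ∷ []) ∷ (# 9 ∷ # 1 ∷ []) ∷ (# 0 ∷ # 6 ∷ []) ∷ (# 3 ∷ # 1 ∷ []) ∷ (# 3 ∷ # 1 ∷ []) ∷ (# 9 ∷ # 1 ∷ []) ∷ [])
      ∷ ((# 0 ∷ # 2 ∷ []) ∷ (# 0 ∷ # 2 ∷ []) ∷ (# 0 ∷ # 2 ∷ []) ∷ (# 3 ∷ # 2 ∷ []) ∷ (# 4 ∷ # 2 ∷ []) ∷ (# 0 ∷ # 5 ∷ []) ∷ (# 0 ∷ # 2 ∷ []) ∷ (# 0 ∷ # 7 ∷ []) ∷ (# 3 ∷ # 2 ∷ []) ∷ (# 0 ∷ # 9 ∷ []) ∷ [])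
      ∷ ((# 0 ∷ # 3 ∷ []) ∷ (# 0 ∷ # 3 ∷ []) ∷ (# 9 ∷ # 3 ∷ []) ∷ (# 0 ∷ # 3 ∷ []) ∷ (# 4 ∷ # 3 ∷ []) ∷ (# 0 ∷ # 3 ∷ []) ∷ (# 0 ∷ # 3 ∷ []) ∷ (# 9 ∷ # 3 ∷ []) ∷ (# 0 ∷ # 8 ∷ []) ∷ (# 9 ∷ # 3 ∷ []) ∷ [])
      ∷ ((# 0 ∷ # 4 ∷ []) ∷ (# 0 ∷ # 4 ∷ []) ∷ (# 3 ∷ # 7 ∷ []) ∷ (# 3 ∷ # 4 ∷ []) ∷ (# 0 ∷ # 4 ∷ []) ∷ (# 0 ∷ # 7 ∷ []) ∷ (# 0 ∷ # 4 ∷ []) ∷ (# 0 ∷ # 7 ∷ []) ∷ (# 3 ∷ # 4 ∷ []) ∷ (# 0 ∷ # 9 ∷ []) ∷ [])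
      ∷ [])
    ∷ ( ((# 0 ∷ # 0 ∷ []) ∷ (# 0 ∷ # 1 ∷ []) ∷ (# 7 ∷ # 4 ∷ []) ∷ (# 0 ∷ # 4 ∷ []) ∷ (# 0 ∷ # 4 ∷ []) ∷ (# 0 ∷ # 5 ∷ []) ∷ (# 0 ∷ # 1 ∷ []) ∷ (# 7 ∷ # 0 ∷ []) ∷ (# 0 ∷ # 4 ∷ []) ∷ (# 5 ∷ # 4 ∷ []) ∷ [])
      ∷ ((# 0 ∷ # 0 ∷ []) ∷ (# 0 ∷ # 1 ∷ []) ∷ (# 0 ∷ # 0 ∷ []) ∷ (# 0 ∷ # 0 ∷ []) ∷ (# 0 ∷ # 0 ∷ []) ∷ (# 5 ∷ # 0 ∷ []) ∷ (# 0 ∷ # 6 ∷ []) ∷ (# 7 ∷ # 0 ∷ []) ∷ (# 0 ∷ # 0 ∷ []) ∷ (# 7 ∷ # 0 ∷ []) ∷ [])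
      ∷ ((# 0 ∷ # 2 ∷ []) ∷ (# 0 ∷ # 2 ∷ []) ∷ (# 0 ∷ # 2 ∷ []) ∷ (# 0 ∷ # 3 ∷ []) ∷ (# 0 ∷ # 2 ∷ []) ∷ (# 5 ∷ # 2 ∷ []) ∷ (# 0 ∷ # 2 ∷ []) ∷ (# 0 ∷ # 7 ∷ []) ∷ (# 0 ∷ # 3 ∷ []) ∷ (# 0 ∷ # 7 ∷ []) ∷ [])
      ∷ ((# 0 ∷ # 2 ∷ []) ∷ (# 0 ∷ # 2 ∷ []) ∷ (# 0 ∷ # 2 ∷ []) ∷ (# 0 ∷ # 3 ∷ []) ∷ (# 0 ∷ # 4 ∷ []) ∷ (# 5 ∷ # 2 ∷ []) ∷ (# 0 ∷ # 2 ∷ []) ∷ (# 7 ∷ # 2 ∷ []) ∷ (# 0 ∷ # 8 ∷ []) ∷ (# 5 ∷ # 4 ∷ []) ∷ [])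
      ∷ ((# 0 ∷ # 0 ∷ []) ∷ (# 0 ∷ # 0 ∷ []) ∷ (# 5 ∷ # 3 ∷ []) ∷ (# 0 ∷ # 3 ∷ []) ∷ (# 0 ∷ # 4 ∷ []) ∷ (# 5 ∷ # 0 ∷ []) ∷ (# 0 ∷ # 0 ∷ []) ∷ (# 7 ∷ # 0 ∷ []) ∷ (# 0 ∷ # 3 ∷ []) ∷ (# 0 ∷ # 9 ∷ []) ∷ [])
      ∷ ((# 0 ∷ # 0 ∷ []) ∷ (# 0 ∷ # 0 ∷ []) ∷ (# 0 ∷ # 0 ∷ []) ∷ (# 0 ∷ # 0 ∷ []) ∷ (# 0 ∷ # 0 ∷ []) ∷ (# 0 ∷ # 5 ∷ []) ∷ (# 0 ∷ # 0 ∷ []) ∷ (# 0 ∷ # 7 ∷ []) ∷ (# 0 ∷ # 0 ∷ []) ∷ (# 0 ∷ # 7 ∷ []) ∷ [])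
      ∷ ((# 0 ∷ # 1 ∷ []) ∷ (# 0 ∷ # 1 ∷ []) ∷ (# 7 ∷ # 1 ∷ []) ∷ (# 7 ∷ # 1 ∷ []) ∷ (# 0 ∷ # 1 ∷ []) ∷ (# 5 ∷ # 1 ∷ []) ∷ (# 0 ∷ # 6 ∷ []) ∷ (# 7 ∷ # 1 ∷ []) ∷ (# 0 ∷ # 1 ∷ []) ∷ (# 0 ∷ # 1 ∷ []) ∷ [])
      ∷ ((# 0 ∷ # 2 ∷ []) ∷ (# 0 ∷ # 2 ∷ []) ∷ (# 0 ∷ # 2 ∷ []) ∷ (# 0 ∷ # 2 ∷ []) ∷ (# 0 ∷ # 2 ∷ []) ∷ (# 0 ∷ # 5 ∷ []) ∷ (# 0 ∷ # 2 ∷ []) ∷ (# 0 ∷ # 7 ∷ []) ∷ (# 0 ∷ # 2 ∷ []) ∷ (# 0 ∷ # 9 ∷ []) ∷ [])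
      ∷ ((# 0 ∷ # 3 ∷ []) ∷ (# 0 ∷ # 3 ∷ []) ∷ (# 5 ∷ # 3 ∷ []) ∷ (# 0 ∷ # 3 ∷ []) ∷ (# 0 ∷ # 3 ∷ []) ∷ (# 5 ∷ # 3 ∷ []) ∷ (# 0 ∷ # 3 ∷ []) ∷ (# 7 ∷ # 3 ∷ []) ∷ (# 0 ∷ # 8 ∷ []) ∷ (# 7 ∷ # 3 ∷ []) ∷ [])
      ∷ ((# 0 ∷ # 4 ∷ []) ∷ (# 0 ∷ # 4 ∷ []) ∷ (# 7 ∷ # 4 ∷ []) ∷ (# 0 ∷ # 4 ∷ []) ∷ (# 0 ∷ # 4 ∷ []) ∷ (# 5 ∷ # 4 ∷ []) ∷ (# 0 ∷ # 4 ∷ []) ∷ (# 0 ∷ # 7 ∷ []) ∷ (# 0 ∷ # 4 ∷ []) ∷ (# 0 ∷ # 9 ∷ []) ∷ [])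
      ∷ [])
    ∷ ( ((# 1 ∷ # 0 ∷ []) ∷ (# 1 ∷ # 0 ∷ []) ∷ (# 1 ∷ # 0 ∷ []) ∷ (# 1 ∷ # 0 ∷ []) ∷ (# 1 ∷ # 4 ∷ []) ∷ (# 1 ∷ # 5 ∷ []) ∷ (# 6 ∷ # 0 ∷ []) ∷ (# 1 ∷ # 0 ∷ []) ∷ (# 1 ∷ # 4 ∷ []) ∷ (# 1 ∷ # 0 ∷ []) ∷ [])
      ∷ ((# 1 ∷ # 0 ∷ []) ∷ (# 1 ∷ # 0 ∷ []) ∷ (# 1 ∷ # 0 ∷ []) ∷ (# 1 ∷ # 0 ∷ []) ∷ (# 1 ∷ # 0 ∷ []) ∷ (# 1 ∷ # 0 ∷ []) ∷ (# 1 ∷ # 6 ∷ []) ∷ (# 1 ∷ # 0 ∷ []) ∷ (# 1 ∷ # 0 ∷ []) ∷ (# 1 ∷ # 0 ∷ []) ∷ [])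
      ∷ ((# 1 ∷ # 3 ∷ []) ∷ (# 1 ∷ # 2 ∷ []) ∷ (# 1 ∷ # 2 ∷ []) ∷ (# 1 ∷ # 3 ∷ []) ∷ (# 1 ∷ # 2 ∷ []) ∷ (# 1 ∷ # 7 ∷ []) ∷ (# 6 ∷ # 2 ∷ []) ∷ (# 1 ∷ # 7 ∷ []) ∷ (# 1 ∷ # 3 ∷ []) ∷ (# 1 ∷ # 2 ∷ []) ∷ [])
      ∷ ((# 1 ∷ # 3 ∷ []) ∷ (# 1 ∷ # 2 ∷ []) ∷ (# 1 ∷ # 2 ∷ []) ∷ (# 1 ∷ # 3 ∷ []) ∷ (# 1 ∷ # 4 ∷ []) ∷ (# 1 ∷ # 2 ∷ []) ∷ (# 6 ∷ # 2 ∷ []) ∷ (# 1 ∷ # 2 ∷ []) ∷ (# 1 ∷ # 8 ∷ []) ∷ (# 1 ∷ # 2 ∷ []) ∷ [])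
      ∷ ((# 1 ∷ # 0 ∷ []) ∷ (# 1 ∷ # 0 ∷ []) ∷ (# 1 ∷ # 3 ∷ []) ∷ (# 1 ∷ # 3 ∷ []) ∷ (# 1 ∷ # 4 ∷ []) ∷ (# 1 ∷ # 9 ∷ []) ∷ (# 6 ∷ # 0 ∷ []) ∷ (# 1 ∷ # 3 ∷ []) ∷ (# 1 ∷ # 3 ∷ []) ∷ (# 1 ∷ # 9 ∷ []) ∷ [])
      ∷ ((# 1 ∷ # 0 ∷ []) ∷ (# 1 ∷ # 0 ∷ []) ∷ (# 1 ∷ # 7 ∷ []) ∷ (# 1 ∷ # 7 ∷ []) ∷ (# 1 ∷ # 0 ∷ []) ∷ (# 1 ∷ # 5 ∷ []) ∷ (# 6 ∷ # 0 ∷ []) ∷ (# 1 ∷ # 7 ∷ []) ∷ (# 1 ∷ # 0 ∷ []) ∷ (# 1 ∷ # 0 ∷ []) ∷ [])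
      ∷ ((# 1 ∷ # 1 ∷ []) ∷ (# 1 ∷ # 1 ∷ []) ∷ (# 1 ∷ # 1 ∷ []) ∷ (# 1 ∷ # 1 ∷ []) ∷ (# 1 ∷ # 1 ∷ []) ∷ (# 1 ∷ # 1 ∷ []) ∷ (# 1 ∷ # 6 ∷ []) ∷ (# 1 ∷ # 1 ∷ []) ∷ (# 1 ∷ # 1 ∷ []) ∷ (# 1 ∷ # 1 ∷ []) ∷ [])
      ∷ ((# 1 ∷ # 9 ∷ []) ∷ (# 1 ∷ # 2 ∷ []) ∷ (# 1 ∷ # 2 ∷ []) ∷ (# 1 ∷ # 2 ∷ []) ∷ (# 1 ∷ # 2 ∷ []) ∷ (# 1 ∷ # 5 ∷ []) ∷ (# 6 ∷ # 2 ∷ []) ∷ (# 1 ∷ # 7 ∷ []) ∷ (# 1 ∷ # 2 ∷ []) ∷ (# 1 ∷ # 9 ∷ []) ∷ [])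
      ∷ ((# 1 ∷ # 3 ∷ []) ∷ (# 1 ∷ # 3 ∷ []) ∷ (# 1 ∷ # 3 ∷ []) ∷ (# 1 ∷ # 3 ∷ []) ∷ (# 1 ∷ # 3 ∷ []) ∷ (# 1 ∷ # 3 ∷ []) ∷ (# 6 ∷ # 3 ∷ []) ∷ (# 1 ∷ # 3 ∷ []) ∷ (# 1 ∷ # 8 ∷ []) ∷ (# 1 ∷ # 3 ∷ []) ∷ [])
      ∷ ((# 1 ∷ # 4 ∷ []) ∷ (# 1 ∷ # 4 ∷ []) ∷ (# 1 ∷ # 7 ∷ []) ∷ (# 1 ∷ # 7 ∷ []) ∷ (# 1 ∷ # 4 ∷ []) ∷ (# 1 ∷ # 7 ∷ []) ∷ (# 6 ∷ # 4 ∷ []) ∷ (# 1 ∷ # 7 ∷ []) ∷ (# 1 ∷ # 4 ∷ []) ∷ (# 1 ∷ # 9 ∷ []) ∷ [])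
      ∷ [])
    ∷ ( ((# 2 ∷ # 0 ∷ []) ∷ (# 2 ∷ # 1 ∷ []) ∷ (# 2 ∷ # 0 ∷ []) ∷ (# 2 ∷ # 0 ∷ []) ∷ (# 2 ∷ # 4 ∷ []) ∷ (# 2 ∷ # 5 ∷ []) ∷ (# 2 ∷ # 1 ∷ []) ∷ (# 7 ∷ # 0 ∷ []) ∷ (# 2 ∷ # 0 ∷ []) ∷ (# 9 ∷ # 0 ∷ []) ∷ [])
      ∷ ((# 2 ∷ # 0 ∷ []) ∷ (# 2 ∷ # 1 ∷ []) ∷ (# 2 ∷ # 0 ∷ []) ∷ (# 2 ∷ # 0 ∷ []) ∷ (# 2 ∷ # 0 ∷ []) ∷ (# 5 ∷ # 0 ∷ []) ∷ (# 2 ∷ # 6 ∷ []) ∷ (# 7 ∷ # 0 ∷ []) ∷ (# 2 ∷ # 0 ∷ []) ∷ (# 9 ∷ # 0 ∷ []) ∷ [])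
      ∷ ((# 5 ∷ # 2 ∷ []) ∷ (# 5 ∷ # 2 ∷ []) ∷ (# 2 ∷ # 2 ∷ []) ∷ (# 2 ∷ # 3 ∷ []) ∷ (# 5 ∷ # 3 ∷ []) ∷ (# 5 ∷ # 2 ∷ []) ∷ (# 5 ∷ # 2 ∷ []) ∷ (# 2 ∷ # 7 ∷ []) ∷ (# 2 ∷ # 3 ∷ []) ∷ (# 9 ∷ # 2 ∷ []) ∷ [])
      ∷ ((# 2 ∷ # 4 ∷ []) ∷ (# 2 ∷ # 4 ∷ []) ∷ (# 2 ∷ # 2 ∷ []) ∷ (# 2 ∷ # 3 ∷ []) ∷ (# 2 ∷ # 4 ∷ []) ∷ (# 5 ∷ # 2 ∷ []) ∷ (# 2 ∷ # 4 ∷ []) ∷ (# 7 ∷ # 2 ∷ []) ∷ (# 2 ∷ # 8 ∷ []) ∷ (# 9 ∷ # 2 ∷ []) ∷ [])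
      ∷ ((# 2 ∷ # 0 ∷ []) ∷ (# 2 ∷ # 0 ∷ []) ∷ (# 2 ∷ # 0 ∷ []) ∷ (# 2 ∷ # 3 ∷ []) ∷ (# 2 ∷ # 4 ∷ []) ∷ (# 5 ∷ # 0 ∷ []) ∷ (# 2 ∷ # 0 ∷ []) ∷ (# 7 ∷ # 0 ∷ []) ∷ (# 2 ∷ # 3 ∷ []) ∷ (# 2 ∷ # 9 ∷ []) ∷ [])
      ∷ ((# 2 ∷ # 0 ∷ []) ∷ (# 2 ∷ # 0 ∷ []) ∷ (# 2 ∷ # 0 ∷ []) ∷ (# 2 ∷ # 0 ∷ []) ∷ (# 2 ∷ # 0 ∷ []) ∷ (# 2 ∷ # 5 ∷ []) ∷ (# 2 ∷ # 0 ∷ []) ∷ (# 2 ∷ # 7 ∷ []) ∷ (# 2 ∷ # 0 ∷ []) ∷ (# 9 ∷ # 0 ∷ []) ∷ [])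
      ∷ ((# 9 ∷ # 1 ∷ []) ∷ (# 2 ∷ # 1 ∷ []) ∷ (# 2 ∷ # 1 ∷ []) ∷ (# 2 ∷ # 1 ∷ []) ∷ (# 2 ∷ # 1 ∷ []) ∷ (# 5 ∷ # 1 ∷ []) ∷ (# 2 ∷ # 6 ∷ []) ∷ (# 7 ∷ # 1 ∷ []) ∷ (# 2 ∷ # 1 ∷ []) ∷ (# 9 ∷ # 1 ∷ []) ∷ [])
      ∷ ((# 2 ∷ # 5 ∷ []) ∷ (# 2 ∷ # 5 ∷ []) ∷ (# 2 ∷ # 2 ∷ []) ∷ (# 2 ∷ # 9 ∷ []) ∷ (# 2 ∷ # 5 ∷ []) ∷ (# 2 ∷ # 5 ∷ []) ∷ (# 2 ∷ # 5 ∷ []) ∷ (# 2 ∷ # 7 ∷ []) ∷ (# 2 ∷ # 2 ∷ []) ∷ (# 2 ∷ # 9 ∷ []) ∷ [])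
      ∷ ((# 5 ∷ # 3 ∷ []) ∷ (# 5 ∷ # 3 ∷ []) ∷ (# 2 ∷ # 3 ∷ []) ∷ (# 2 ∷ # 3 ∷ []) ∷ (# 5 ∷ # 3 ∷ []) ∷ (# 5 ∷ # 3 ∷ []) ∷ (# 5 ∷ # 3 ∷ []) ∷ (# 7 ∷ # 3 ∷ []) ∷ (# 2 ∷ # 8 ∷ []) ∷ (# 9 ∷ # 3 ∷ []) ∷ [])
      ∷ ((# 2 ∷ # 4 ∷ []) ∷ (# 2 ∷ # 4 ∷ []) ∷ (# 2 ∷ # 4 ∷ []) ∷ (# 2 ∷ # 4 ∷ []) ∷ (# 2 ∷ # 4 ∷ []) ∷ (# 5 ∷ # 4 ∷ []) ∷ (# 2 ∷ # 4 ∷ []) ∷ (# 2 ∷ # 7 ∷ []) ∷ (# 2 ∷ # 4 ∷ []) ∷ (# 2 ∷ # 9 ∷ []) ∷ [])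
      ∷ [])
    ∷ ( ((# 3 ∷ # 0 ∷ []) ∷ (# 3 ∷ # 1 ∷ []) ∷ (# 3 ∷ # 5 ∷ []) ∷ (# 3 ∷ # 0 ∷ []) ∷ (# 3 ∷ # 4 ∷ []) ∷ (# 3 ∷ # 5 ∷ []) ∷ (# 3 ∷ # 1 ∷ []) ∷ (# 3 ∷ # 5 ∷ []) ∷ (# 8 ∷ # 0 ∷ []) ∷ (# 3 ∷ # 5 ∷ []) ∷ [])
      ∷ ((# 3 ∷ # 0 ∷ []) ∷ (# 3 ∷ # 1 ∷ []) ∷ (# 3 ∷ # 0 ∷ []) ∷ (# 3 ∷ # 0 ∷ []) ∷ (# 3 ∷ # 0 ∷ []) ∷ (# 3 ∷ # 0 ∷ []) ∷ (# 3 ∷ # 6 ∷ []) ∷ (# 3 ∷ # 0 ∷ []) ∷ (# 8 ∷ # 0 ∷ []) ∷ (# 3 ∷ # 0 ∷ []) ∷ [])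
      ∷ ((# 3 ∷ # 2 ∷ []) ∷ (# 3 ∷ # 2 ∷ []) ∷ (# 3 ∷ # 2 ∷ []) ∷ (# 3 ∷ # 2 ∷ []) ∷ (# 3 ∷ # 2 ∷ []) ∷ (# 3 ∷ # 2 ∷ []) ∷ (# 3 ∷ # 2 ∷ []) ∷ (# 3 ∷ # 7 ∷ []) ∷ (# 8 ∷ # 2 ∷ []) ∷ (# 3 ∷ # 7 ∷ []) ∷ [])
      ∷ ((# 3 ∷ # 4 ∷ []) ∷ (# 3 ∷ # 4 ∷ []) ∷ (# 3 ∷ # 2 ∷ []) ∷ (# 3 ∷ # 2 ∷ []) ∷ (# 3 ∷ # 4 ∷ []) ∷ (# 3 ∷ # 4 ∷ []) ∷ (# 3 ∷ # 4 ∷ []) ∷ (# 3 ∷ # 2 ∷ []) ∷ (# 3 ∷ # 8 ∷ []) ∷ (# 3 ∷ # 2 ∷ []) ∷ [])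
      ∷ ((# 3 ∷ # 0 ∷ []) ∷ (# 3 ∷ # 0 ∷ []) ∷ (# 3 ∷ # 9 ∷ []) ∷ (# 3 ∷ # 0 ∷ []) ∷ (# 3 ∷ # 4 ∷ []) ∷ (# 3 ∷ # 0 ∷ []) ∷ (# 3 ∷ # 0 ∷ []) ∷ (# 3 ∷ # 9 ∷ []) ∷ (# 8 ∷ # 0 ∷ []) ∷ (# 3 ∷ # 9 ∷ []) ∷ [])
      ∷ ((# 3 ∷ # 0 ∷ []) ∷ (# 3 ∷ # 0 ∷ []) ∷ (# 3 ∷ # 5 ∷ []) ∷ (# 3 ∷ # 0 ∷ []) ∷ (# 3 ∷ # 0 ∷ []) ∷ (# 3 ∷ # 5 ∷ []) ∷ (# 3 ∷ # 0 ∷ []) ∷ (# 3 ∷ # 7 ∷ []) ∷ (# 8 ∷ # 0 ∷ []) ∷ (# 3 ∷ # 7 ∷ []) ∷ [])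
      ∷ ((# 3 ∷ # 1 ∷ []) ∷ (# 3 ∷ # 1 ∷ []) ∷ (# 3 ∷ # 1 ∷ []) ∷ (# 3 ∷ # 1 ∷ []) ∷ (# 3 ∷ # 1 ∷ []) ∷ (# 3 ∷ # 1 ∷ []) ∷ (# 3 ∷ # 6 ∷ []) ∷ (# 3 ∷ # 1 ∷ []) ∷ (# 8 ∷ # 1 ∷ []) ∷ (# 3 ∷ # 1 ∷ []) ∷ [])
      ∷ ((# 3 ∷ # 5 ∷ []) ∷ (# 3 ∷ # 5 ∷ []) ∷ (# 3 ∷ # 2 ∷ []) ∷ (# 3 ∷ # 2 ∷ []) ∷ (# 3 ∷ # 5 ∷ []) ∷ (# 3 ∷ # 5 ∷ []) ∷ (# 3 ∷ # 5 ∷ []) ∷ (# 3 ∷ # 7 ∷ []) ∷ (# 8 ∷ # 2 ∷ []) ∷ (# 3 ∷ # 9 ∷ []) ∷ [])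
      ∷ ((# 3 ∷ # 3 ∷ []) ∷ (# 3 ∷ # 3 ∷ []) ∷ (# 3 ∷ # 3 ∷ []) ∷ (# 3 ∷ # 3 ∷ []) ∷ (# 3 ∷ # 3 ∷ []) ∷ (# 3 ∷ # 3 ∷ []) ∷ (# 3 ∷ # 3 ∷ []) ∷ (# 3 ∷ # 3 ∷ []) ∷ (# 3 ∷ # 8 ∷ []) ∷ (# 3 ∷ # 3 ∷ []) ∷ [])
      ∷ ((# 3 ∷ # 4 ∷ []) ∷ (# 3 ∷ # 4 ∷ []) ∷ (# 3 ∷ # 7 ∷ []) ∷ (# 3 ∷ # 4 ∷ []) ∷ (# 3 ∷ # 4 ∷ []) ∷ (# 3 ∷ # 4 ∷ []) ∷ (# 3 ∷ # 4 ∷ []) ∷ (# 3 ∷ # 7 ∷ []) ∷ (# 8 ∷ # 4 ∷ []) ∷ (# 3 ∷ # 9 ∷ []) ∷ [])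
      ∷ [])
    ∷ ( ((# 4 ∷ # 0 ∷ []) ∷ (# 4 ∷ # 1 ∷ []) ∷ (# 7 ∷ # 4 ∷ []) ∷ (# 4 ∷ # 0 ∷ []) ∷ (# 4 ∷ # 0 ∷ []) ∷ (# 4 ∷ # 5 ∷ []) ∷ (# 4 ∷ # 1 ∷ []) ∷ (# 7 ∷ # 0 ∷ []) ∷ (# 4 ∷ # 0 ∷ []) ∷ (# 9 ∷ # 0 ∷ []) ∷ [])
      ∷ ((# 4 ∷ # 0 ∷ []) ∷ (# 4 ∷ # 1 ∷ []) ∷ (# 4 ∷ # 0 ∷ []) ∷ (# 4 ∷ # 0 ∷ []) ∷ (# 4 ∷ # 0 ∷ []) ∷ (# 7 ∷ # 0 ∷ []) ∷ (# 4 ∷ # 6 ∷ []) ∷ (# 7 ∷ # 0 ∷ []) ∷ (# 4 ∷ # 0 ∷ []) ∷ (# 9 ∷ # 0 ∷ []) ∷ [])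
      ∷ ((# 4 ∷ # 2 ∷ []) ∷ (# 4 ∷ # 2 ∷ []) ∷ (# 4 ∷ # 2 ∷ []) ∷ (# 4 ∷ # 3 ∷ []) ∷ (# 4 ∷ # 2 ∷ []) ∷ (# 4 ∷ # 7 ∷ []) ∷ (# 4 ∷ # 2 ∷ []) ∷ (# 4 ∷ # 7 ∷ []) ∷ (# 4 ∷ # 3 ∷ []) ∷ (# 9 ∷ # 2 ∷ []) ∷ [])
      ∷ ((# 4 ∷ # 2 ∷ []) ∷ (# 4 ∷ # 2 ∷ []) ∷ (# 4 ∷ # 2 ∷ []) ∷ (# 4 ∷ # 3 ∷ []) ∷ (# 4 ∷ # 2 ∷ []) ∷ (# 7 ∷ # 4 ∷ []) ∷ (# 4 ∷ # 2 ∷ []) ∷ (# 7 ∷ # 2 ∷ []) ∷ (# 4 ∷ # 8 ∷ []) ∷ (# 9 ∷ # 2 ∷ []) ∷ [])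
      ∷ ((# 4 ∷ # 0 ∷ []) ∷ (# 4 ∷ # 0 ∷ []) ∷ (# 7 ∷ # 3 ∷ []) ∷ (# 4 ∷ # 3 ∷ []) ∷ (# 4 ∷ # 0 ∷ []) ∷ (# 7 ∷ # 0 ∷ []) ∷ (# 4 ∷ # 0 ∷ []) ∷ (# 7 ∷ # 0 ∷ []) ∷ (# 4 ∷ # 3 ∷ []) ∷ (# 4 ∷ # 9 ∷ []) ∷ [])
      ∷ ((# 4 ∷ # 0 ∷ []) ∷ (# 4 ∷ # 0 ∷ []) ∷ (# 4 ∷ # 7 ∷ []) ∷ (# 4 ∷ # 0 ∷ []) ∷ (# 4 ∷ # 0 ∷ []) ∷ (# 4 ∷ # 5 ∷ []) ∷ (# 4 ∷ # 0 ∷ []) ∷ (# 4 ∷ # 7 ∷ []) ∷ (# 4 ∷ # 0 ∷ []) ∷ (# 9 ∷ # 0 ∷ []) ∷ [])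
      ∷ ((# 4 ∷ # 1 ∷ []) ∷ (# 4 ∷ # 1 ∷ []) ∷ (# 7 ∷ # 1 ∷ []) ∷ (# 7 ∷ # 1 ∷ []) ∷ (# 4 ∷ # 1 ∷ []) ∷ (# 7 ∷ # 1 ∷ []) ∷ (# 4 ∷ # 6 ∷ []) ∷ (# 7 ∷ # 1 ∷ []) ∷ (# 4 ∷ # 1 ∷ []) ∷ (# 9 ∷ # 1 ∷ []) ∷ [])
      ∷ ((# 4 ∷ # 2 ∷ []) ∷ (# 4 ∷ # 2 ∷ []) ∷ (# 4 ∷ # 2 ∷ []) ∷ (# 4 ∷ # 2 ∷ []) ∷ (# 4 ∷ # 2 ∷ []) ∷ (# 4 ∷ # 5 ∷ []) ∷ (# 4 ∷ # 2 ∷ []) ∷ (# 4 ∷ # 7 ∷ []) ∷ (# 4 ∷ # 2 ∷ []) ∷ (# 4 ∷ # 9 ∷ []) ∷ [])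
      ∷ ((# 4 ∷ # 3 ∷ []) ∷ (# 4 ∷ # 3 ∷ []) ∷ (# 7 ∷ # 3 ∷ []) ∷ (# 4 ∷ # 3 ∷ []) ∷ (# 4 ∷ # 3 ∷ []) ∷ (# 4 ∷ # 3 ∷ []) ∷ (# 4 ∷ # 3 ∷ []) ∷ (# 7 ∷ # 3 ∷ []) ∷ (# 4 ∷ # 8 ∷ []) ∷ (# 9 ∷ # 3 ∷ []) ∷ [])
      ∷ ((# 4 ∷ # 4 ∷ []) ∷ (# 4 ∷ # 4 ∷ []) ∷ (# 4 ∷ # 7 ∷ []) ∷ (# 4 ∷ # 4 ∷ []) ∷ (# 4 ∷ # 4 ∷ []) ∷ (# 4 ∷ # 7 ∷ []) ∷ (# 4 ∷ # 4 ∷ []) ∷ (# 4 ∷ # 7 ∷ []) ∷ (# 4 ∷ # 4 ∷ []) ∷ (# 4 ∷ # 9 ∷ []) ∷ [])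
      ∷ [])
    ∷ [])
  ∷ []

G₁-rank : Table (static G₁) 1 ℕ
G₁-rank =
  ( (1 ∷ 1 ∷ 6 ∷ 6 ∷ 1 ∷ 6 ∷ 6 ∷ 3 ∷ 6 ∷ 6 ∷ [])
    ∷ (1 ∷ 1 ∷ 1 ∷ 5 ∷ 2 ∷ 5 ∷ 5 ∷ 2 ∷ 5 ∷ 5 ∷ [])
    ∷ (3 ∷ 1 ∷ 1 ∷ 1 ∷ 3 ∷ 3 ∷ 4 ∷ 1 ∷ 4 ∷ 4 ∷ [])
    ∷ (4 ∷ 4 ∷ 1 ∷ 1 ∷ 4 ∷ 2 ∷ 3 ∷ 2 ∷ 1 ∷ 3 ∷ [])
    ∷ (1 ∷ 7 ∷ 7 ∷ 7 ∷ 1 ∷ 7 ∷ 7 ∷ 7 ∷ 7 ∷ 7 ∷ [])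
    ∷ (6 ∷ 6 ∷ 6 ∷ 6 ∷ 6 ∷ 1 ∷ 3 ∷ 6 ∷ 1 ∷ 3 ∷ [])
    ∷ (6 ∷ 6 ∷ 6 ∷ 6 ∷ 6 ∷ 2 ∷ 1 ∷ 6 ∷ 1 ∷ 1 ∷ [])
    ∷ (4 ∷ 4 ∷ 1 ∷ 5 ∷ 4 ∷ 5 ∷ 5 ∷ 1 ∷ 5 ∷ 5 ∷ [])
    ∷ (5 ∷ 5 ∷ 5 ∷ 1 ∷ 5 ∷ 1 ∷ 1 ∷ 3 ∷ 1 ∷ 2 ∷ [])
    ∷ (7 ∷ 7 ∷ 7 ∷ 7 ∷ 7 ∷ 3 ∷ 1 ∷ 7 ∷ 7 ∷ 1 ∷ [])
    ∷ [])
  ∷ []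

G₁-strategy : Table (static G₁) 1 (Config 10 1)
G₁-strategy =
  ( ((# 0 ∷ []) ∷ (# 1 ∷ []) ∷ (# 1 ∷ []) ∷ (# 1 ∷ []) ∷ (# 4 ∷ []) ∷ (# 1 ∷ []) ∷ (# 1 ∷ []) ∷ (# 1 ∷ []) ∷ (# 1 ∷ []) ∷ (# 1 ∷ []) ∷ [])
    ∷ ((# 0 ∷ []) ∷ (# 1 ∷ []) ∷ (# 2 ∷ []) ∷ (# 2 ∷ []) ∷ (# 0 ∷ []) ∷ (# 2 ∷ []) ∷ (# 2 ∷ []) ∷ (# 2 ∷ []) ∷ (# 2 ∷ []) ∷ (# 2 ∷ []) ∷ [])
    ∷ ((# 1 ∷ []) ∷ (# 1 ∷ []) ∷ (# 2 ∷ []) ∷ (# 3 ∷ []) ∷ (# 1 ∷ []) ∷ (# 3 ∷ []) ∷ (# 3 ∷ []) ∷ (# 7 ∷ []) ∷ (# 3 ∷ []) ∷ (# 3 ∷ []) ∷ [])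
    ∷ ((# 2 ∷ []) ∷ (# 2 ∷ []) ∷ (# 2 ∷ []) ∷ (# 3 ∷ []) ∷ (# 2 ∷ []) ∷ (# 8 ∷ []) ∷ (# 8 ∷ []) ∷ (# 2 ∷ []) ∷ (# 8 ∷ []) ∷ (# 8 ∷ []) ∷ [])
    ∷ ((# 0 ∷ []) ∷ (# 0 ∷ []) ∷ (# 0 ∷ []) ∷ (# 0 ∷ []) ∷ (# 4 ∷ []) ∷ (# 0 ∷ []) ∷ (# 0 ∷ []) ∷ (# 0 ∷ []) ∷ (# 0 ∷ []) ∷ (# 0 ∷ []) ∷ [])
    ∷ ((# 8 ∷ []) ∷ (# 8 ∷ []) ∷ (# 8 ∷ []) ∷ (# 8 ∷ []) ∷ (# 8 ∷ []) ∷ (# 5 ∷ []) ∷ (# 8 ∷ []) ∷ (# 8 ∷ []) ∷ (# 8 ∷ []) ∷ (# 8 ∷ []) ∷ [])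
    ∷ ((# 8 ∷ []) ∷ (# 8 ∷ []) ∷ (# 8 ∷ []) ∷ (# 8 ∷ []) ∷ (# 8 ∷ []) ∷ (# 8 ∷ []) ∷ (# 6 ∷ []) ∷ (# 8 ∷ []) ∷ (# 8 ∷ []) ∷ (# 9 ∷ []) ∷ [])
    ∷ ((# 2 ∷ []) ∷ (# 2 ∷ []) ∷ (# 2 ∷ []) ∷ (# 2 ∷ []) ∷ (# 2 ∷ []) ∷ (# 2 ∷ []) ∷ (# 2 ∷ []) ∷ (# 7 ∷ []) ∷ (# 2 ∷ []) ∷ (# 2 ∷ []) ∷ [])
    ∷ ((# 3 ∷ []) ∷ (# 3 ∷ []) ∷ (# 3 ∷ []) ∷ (# 3 ∷ []) ∷ (# 3 ∷ []) ∷ (# 5 ∷ []) ∷ (# 6 ∷ []) ∷ (# 3 ∷ []) ∷ (# 8 ∷ []) ∷ (# 6 ∷ []) ∷ [])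
    ∷ ((# 6 ∷ []) ∷ (# 6 ∷ []) ∷ (# 6 ∷ []) ∷ (# 6 ∷ []) ∷ (# 6 ∷ []) ∷ (# 6 ∷ []) ∷ (# 6 ∷ []) ∷ (# 6 ∷ []) ∷ (# 6 ∷ []) ∷ (# 9 ∷ []) ∷ [])
    ∷ [])
  ∷ []

split-petersen-cop-number : CopNumber split-petersen 1
split-petersen-cop-number = cop-number (# 0)
  (Split.cops-win-by-ranking 1 split-petersen-rank split-petersen-strategy (# 0 ∷ []) _)
  (no-cops-lose (# 0))

G₁-cop-number : CopNumber (static G₁) 1
G₁-cop-number = cop-number (# 0)
  (Layer₁.cops-win-by-ranking 1 G₁-rank G₁-strategy (# 0 ∷ []) _)
  (no-cops-lose (# 0))

five-cycle : List ℕ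
five-cycle = 0 ∷ 4 ∷ 9 ∷ 7 ∷ 5 ∷ []

-- Against one cop the robber stays on the induced 5-cycle, outside the cop's closed
-- neighbourhood: every other vertex of G₀ is adjacent to at most one cycle vertex.
G₀-cop-number : CopNumber (static G₀) 2
G₀-cop-number = cop-number (# 0)
  (Layer₀.cops-win-by-ranking 2 G₀-rank G₀-strategy (# 0 ∷ # 0 ∷ []) _)
  (Layer₀.robber-wins-by-evasion 1 _ (λ r → toℕ r ∈? five-cycle) _ _)
  where open DecMembership ℕ._≟_ using (_∈?_)

petersen-cop-number : CopNumber (static petersen) 3
petersen-cop-number = cop-number (# 0)
  (Petersen.cops-win-by-domination 3 (# 0 ∷ # 2 ∷ # 6 ∷ []) _)
  (Petersen.robber-wins-by-evasion 2 _ (λ _ → ⊤-dec) _ _)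

split-petersen-max-layer : MaxLayerCopNumber split-petersen 2
split-petersen-max-layer =
  (λ { zero → 2 , G₀-cop-number , ≤-refl ; (suc zero) → 1 , G₁-cop-number , n≤1+n 1 }) ,
  zero , G₀-cop-number

petersen-connected : Connected petersen
petersen-connected = connected-by-diameter petersen petersen-adj? 2 (# 0) _

lemma5 : ∃[ n ] Σ (PeriodicGraph n) λ 𝒢 →
           Connected (footprint 𝒢) ×
           ∃[ a ] ∃[ b ] ∃[ c ]
             CopNumber 𝒢 a × MaxLayerCopNumber 𝒢 b ×
             CopNumber (static (footprint 𝒢)) c ×
             a < b × b < c
lemma5 = 10 , split-petersen , petersen-connected , 1 , 2 , 3 ,
  split-petersen-cop-number , split-petersen-max-layer , petersen-cop-number , n<1+n 1 , n<1+n 2
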